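{- Every two-edge connected $C_{\geq 5}$-free finite simple graph is either all-round or bipartite all-round.
   Context: For a graph $G=(V,E)$ and $f\colon V\to\{0,1,2,3\}$, a connected mod-4 $f$-factor is a vector $\mathbf{x}\in\{0,1,2,3\}^E$ with $\sum_{e\in\delta(v)}x_e\equiv f(v)\pmod 4$ for all $v\in V$ ($\delta(v)$ = edges incident to $v$) such that the graph $(V,\{e\in E\mid x_e>0\})$ is connected. $G$ is all-round if it has a connected mod-4 $f$-factor for every $f\colon V\to\{0,1,2,3\}$ with $\sum_{v\in V}f(v)$ even. A bipartite $G$ with bipartition classes $U,W$ is bipartite all-round if it has a connected mod-4 $f$-factor for every $f\colon V\to\{0,1,2,3\}$ with $\sum_{v\in U}f(v)\equiv\sum_{v\in W}f(v)\pmod 4$. A graph is $C_{\geq 5}$-free if it has no induced subgraph isomorphic to a cycle $C_k$ with $k\geq 5$ vertices. -}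

module Defs where

open import Data.Nat using (ℕ; zero; suc; _+_; _%_; _≥_)
open import Data.Fin using (Fin; toℕ)
import Data.Fin as F
open import Data.Bool using (Bool; true; false; if_then_else_)
open import Data.Product using (Σ; _×_; ∃; _,_)
open import Data.Sum using (_⊎_)
open import Data.Empty using (⊥)
open import Relation.Nullary using (¬_)
open import Relation.Binary.PropositionalEquality using (_≡_; _≢_)
open import Relation.Binary.Construct.Closure.ReflexiveTransitive using (Star)
open import Function.Definitions using (Injective)
open import Function.Bundles using (_⇔_)

record SimpleGraph (n : ℕ) : Set where
  field
    adj   : Fin n → Fin n → Bool
    sym   : ∀ u v → adj u v ≡ adj v u
    loopless : ∀ v → adj v v ≡ false
open SimpleGraph public

Adj : ∀ {n} → SimpleGraph n → Fin n → Fin n → Set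
Adj G u v = adj G u v ≡ true

sumFin : (n : ℕ) → (Fin n → ℕ) → ℕ
sumFin zero    g = 0
sumFin (suc n) g = g F.zero + sumFin n (λ i → g (F.suc i))

ConnectedRel : ∀ {n} → (Fin n → Fin n → Set) → Set
ConnectedRel {n} R = ∀ (u v : Fin n) → Star R u v

Connected : ∀ {n} → SimpleGraph n → Set
Connected G = ConnectedRel (Adj G)

AdjMinus : ∀ {n} → SimpleGraph n → Fin n → Fin n → Fin n → Fin n → Set
AdjMinus G a b u v = Adj G u v × ¬ ((u ≡ a × v ≡ b) ⊎ (u ≡ b × v ≡ a))

TwoEdgeConnected : ∀ {n} → SimpleGraph n → Set
TwoEdgeConnected G =
  Connected G × (∀ a b → Adj G a b → ConnectedRel (AdjMinus G a b))

-- i and j are consecutive in the cyclic order of Fin k.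
CycNext : ∀ {k} → Fin k → Fin k → Set
CycNext {k} i j = toℕ j ≡ (suc (toℕ i)) % (suc (pred' k))
  where
  pred' : ℕ → ℕ
  pred' zero = zero
  pred' (suc m) = m

CycAdj : ∀ {k} → Fin k → Fin k → Set
CycAdj i j = CycNext i j ⊎ CycNext j i

HasInducedCycle : ∀ {n} → SimpleGraph n → ℕ → Set
HasInducedCycle {n} G k =
  Σ (Fin k → Fin n) λ c → Injective _≡_ _≡_ c ×
    (∀ i j → (Adj G (c i) (c j) ⇔ CycAdj i j))

C≥5-free : ∀ {n} → SimpleGraph n → Set
C≥5-free G = ∀ k → k ≥ 5 → ¬ HasInducedCycle G k

-- An edge vector x ∈ {0,1,2,3}^E, encoded as a symmetric Fin 4-valued
-- matrix; only the entries on edges of G are used.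
record EdgeVec (n : ℕ) : Set where
  field
    val : Fin n → Fin n → Fin 4
    val-sym : ∀ u v → val u v ≡ val v u
open EdgeVec public

degSum : ∀ {n} → SimpleGraph n → EdgeVec n → Fin n → ℕ
degSum {n} G x v = sumFin n (λ w → if adj G v w then toℕ (val x v w) else 0)

IsConnMod4Factor : ∀ {n} → SimpleGraph n → (Fin n → Fin 4) → EdgeVec n → Set
IsConnMod4Factor {n} G f x =
  (∀ v → degSum G x v % 4 ≡ toℕ (f v)) ×
  ConnectedRel (λ u v → Adj G u v × val x u v ≢ F.zero)

HasConnMod4Factor : ∀ {n} → SimpleGraph n → (Fin n → Fin 4) → Set
HasConnMod4Factor {n} G f = ∃ λ (x : EdgeVec n) → IsConnMod4Factor G f x

AllRound : ∀ {n} → SimpleGraph n → Set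
AllRound {n} G = ∀ (f : Fin n → Fin 4) →
  sumFin n (λ v → toℕ (f v)) % 2 ≡ 0 → HasConnMod4Factor G f

-- A bipartition (U = colour true, W = colour false) of G.
IsBipartition : ∀ {n} → SimpleGraph n → (Fin n → Bool) → Set
IsBipartition G c = ∀ u v → Adj G u v → c u ≢ c v

BipartiteAllRound : ∀ {n} → SimpleGraph n → Set
BipartiteAllRound {n} G = Σ (Fin n → Bool) λ c → IsBipartition G c ×
  (∀ (f : Fin n → Fin 4) →
     sumFin n (λ v → if c v then toℕ (f v) else 0) % 4
       ≡ sumFin n (λ v → if c v then 0 else toℕ (f v)) % 4 →
     HasConnMod4Factor G f)

-- Grow a vertex set S from a single vertex, one ear at a time, keeping one of two invariants: either
-- every f on S with Σ_S f even has a connected mod-4 f-factor inside S (a general stage), or S has a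
-- 2-colouring c such that every f with Σ_U f ≡ Σ_W f (mod 4) on its colour classes has one using only edges
-- between the classes (a bipartite stage). To absorb an ear, fix the value t of its first edge: the
-- demands of the inner vertices force all further values, and the old part must then meet f shifted by
-- the values entering it at the two ends. A finite check over ℤ/4 shows that some t keeps the old part
-- balanced and joins every inner vertex to S by nonzero edges, for ears with at most three inner vertices
-- (at most two when the ear breaks the colouring, which makes the stage general). In a 2-edge-connected
-- C≥5-free graph an edge leaving S lies on a triangle or an induced square, which supplies such an ear.
-- Once S is everything, a bipartite stage either has a monochromatic edge, which is absorbed as an ear
-- without inner vertices into a general stage, or G itself is bipartite.

module Submission where

open import Defs hiding (sym)
open import Data.Nat using (ℕ; zero; suc; _+_; _*_; _%_; _/_; _≤_; _<_; z≤n; s≤s)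
open import Data.Nat.Properties
open import Data.Nat.DivMod using (m≡m%n+[m/n]*n; %-distribˡ-+; %-distribˡ-*; [m+kn]%n≡m%n; m%n%n≡m%n; m%n<n; m<n⇒m%n≡m; n%n≡0)
open import Data.Nat.Induction using (<-wellFounded)
open import Data.Nat.Tactic.RingSolver using (solve-∀)
open import Algebra.Properties.CommutativeSemigroup +-commutativeSemigroup using () renaming (interchange to +-interchange)
open import Data.Fin using (Fin; toℕ)
import Data.Fin as F
import Data.Fin.Properties as FP
open import Data.Bool using (Bool; true; false; not; _∧_; _∨_; _xor_; if_then_else_; T)
open import Data.Bool.Properties using (∧-comm; xor-comm; ∧-zeroʳ; ∨-zeroʳ; not-involutive; xor-same; ¬-not; T-∧; T-∨)
import Data.Bool.Properties as BP
open import Data.List using (List; []; _∷_; length; map; replicate)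
open import Data.List.Properties using (length-map; map-∘; ∷-injective; map-cong-local)
open import Data.List.Relation.Unary.All as All using (All; []; _∷_)
open import Data.List.Relation.Unary.AllPairs using (AllPairs; []; _∷_)
open import Data.List.Relation.Unary.Unique.Propositional using (Unique)
open import Data.List.Relation.Unary.Any using (here; there)
open import Data.Product using (Σ; ∃; _×_; _,_; proj₁; proj₂)
open import Data.Sum using (_⊎_; inj₁; inj₂)
open import Data.Unit using (⊤)
open import Data.Empty using (⊥-elim)
open import Function using (_∘_; _$_; _on_)
open import Function.Bundles using (Equivalence; mk⇔)
open import Induction.WellFounded using (Acc; acc)
open import Relation.Nullary using (¬_; Dec; yes; no; does)
open import Relation.Nullary.Decidable using (isNo; map′; _×-dec_; _⊎-dec_; _→-dec_; ¬?; T?; True; toWitness; toWitnessFalse; dec-true; dec-false)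
open import Relation.Binary using (IsEquivalence; Setoid)
open import Relation.Binary.Definitions using (Decidable; DecidableEquality; tri<; tri≈; tri>)
open import Relation.Binary.PropositionalEquality
import Relation.Binary.Reasoning.Setoid as SetoidReasoning
open import Relation.Binary.Construct.Closure.ReflexiveTransitive using (Star; ε; _◅_; _◅◅_)
import Relation.Binary.Construct.Closure.ReflexiveTransitive as Star

infix 4 _≡₄_
record _≡₄_ (a b : ℕ) : Set where
  constructor mod4
  field mod4-eq : a % 4 ≡ b % 4
open _≡₄_ public

≡₄-isEquivalence : IsEquivalence _≡₄_
≡₄-isEquivalence = record
  { refl = mod4 refl
  ; sym = λ (mod4 p) → mod4 (sym p)
  ; trans = λ (mod4 p) (mod4 q) → mod4 (trans p q)
  }

≡₄-setoid : Setoid _ _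
≡₄-setoid = record { isEquivalence = ≡₄-isEquivalence }

open IsEquivalence ≡₄-isEquivalence public
  using () renaming (refl to ≡₄-refl; sym to ≡₄-sym; trans to ≡₄-trans; reflexive to ≡⇒≡₄)

module ≡₄-Reasoning = SetoidReasoning ≡₄-setoid

_≡₄?_ : ∀ a b → Dec (a ≡₄ b)
a ≡₄? b = map′ mod4 mod4-eq (a % 4 ≟ b % 4)

+-cong₄ : ∀ {a a' b b'} → a ≡₄ a' → b ≡₄ b' → a + b ≡₄ a' + b'
+-cong₄ {a} {a'} {b} {b'} (mod4 p) (mod4 q) = mod4 (begin
  (a + b) % 4             ≡⟨ %-distribˡ-+ a b 4 ⟩
  (a % 4 + b % 4) % 4     ≡⟨ cong₂ (λ x y → (x + y) % 4) p q ⟩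
  (a' % 4 + b' % 4) % 4   ≡⟨ %-distribˡ-+ a' b' 4 ⟨
  (a' + b') % 4           ∎)
  where open ≡-Reasoning

*-congˡ₄ : ∀ k {a a'} → a ≡₄ a' → k * a ≡₄ k * a'
*-congˡ₄ k {a} {a'} (mod4 p) = mod4 (begin
  (k * a) % 4               ≡⟨ %-distribˡ-* k a 4 ⟩
  (k % 4 * (a % 4)) % 4     ≡⟨ cong (λ x → (k % 4 * x) % 4) p ⟩
  (k % 4 * (a' % 4)) % 4    ≡⟨ %-distribˡ-* k a' 4 ⟨
  (k * a') % 4              ∎)
  where open ≡-Reasoning

*-congʳ₄ : ∀ k {a a'} → a ≡₄ a' → a * k ≡₄ a' * k
*-congʳ₄ k {a} {a'} a≡a' =
  ≡₄-trans (≡⇒≡₄ (*-comm a k)) (≡₄-trans (*-congˡ₄ k a≡a') (≡⇒≡₄ (*-comm k a')))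

+-4*-≡₄ : ∀ a b → a + 4 * b ≡₄ a
+-4*-≡₄ a b = mod4 (trans (cong (λ x → (a + x) % 4) (*-comm 4 b)) ([m+kn]%n≡m%n a b 4))

+-3*-+-≡₄ : ∀ a b → a + 3 * b + b ≡₄ a
+-3*-+-≡₄ a b = ≡₄-trans (≡⇒≡₄ (shuffle a b)) (+-4*-≡₄ a b)
  where shuffle : ∀ a b → a + 3 * b + b ≡ a + 4 * b
        shuffle = solve-∀

%4-≡₄ : ∀ a → a % 4 ≡₄ a
%4-≡₄ a = mod4 (m%n%n≡m%n a 4)

even⇒2*≡₄0 : ∀ m → m % 2 ≡ 0 → 2 * m ≡₄ 0
even⇒2*≡₄0 m m%2≡0 =
  ≡₄-trans (≡⇒≡₄ (trans (cong (2 *_) m≡2k) (double (m / 2)))) (+-4*-≡₄ 0 (m / 2))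
  where
  m≡2k : m ≡ m / 2 * 2
  m≡2k = trans (m≡m%n+[m/n]*n m 2) (cong (_+ m / 2 * 2) m%2≡0)
  double : ∀ k → 2 * (k * 2) ≡ 0 + 4 * k
  double = solve-∀

residue : ℕ → Fin 4
residue m = F.fromℕ< (m%n<n m 4)

toℕ-residue : ∀ m → toℕ (residue m) ≡₄ m
toℕ-residue m = ≡₄-trans (≡⇒≡₄ (FP.toℕ-fromℕ< (m%n<n m 4))) (%4-≡₄ m)

-- The arithmetic of ears

-- Along an ear the first edge carries t and the edge after an inner vertex of demand r carries r + 3 t,
-- so that the inner vertex receives t + (r + 3 t) ≡ r; an edge is live when its value is nonzero mod 4.
live : ℕ → Bool
live e = isNo (e % 4 ≟ 0)

allLive : ℕ → List ℕ → Bool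
allLive t [] = live t
allLive t (r ∷ rs) = live t ∧ allLive (r + 3 * t) rs

chainEnd : ℕ → List ℕ → ℕ
chainEnd t [] = t
chainEnd t (r ∷ rs) = chainEnd (r + 3 * t) rs

-- ℓ records whether the left end of the current edge is joined to the old part by live edges.
anchored : Bool → ℕ → List ℕ → Bool
anchored ℓ t [] = true
anchored ℓ t (r ∷ rs) = (ℓ ∧ live t ∨ allLive (r + 3 * t) rs) ∧ anchored (ℓ ∧ live t) (r + 3 * t) rs

weighted : List ℕ → List ℕ → ℕ
weighted (w ∷ ws) (r ∷ rs) = w * r + weighted ws rs
weighted _ _ = 0

weighted-map₄ : ∀ {A : Set} ws (xs : List A) {g h : A → ℕ} → (∀ x → g x ≡₄ h x) →
  weighted ws (map g xs) ≡₄ weighted ws (map h xs)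
weighted-map₄ [] xs g≡h = ≡₄-refl
weighted-map₄ (w ∷ ws) [] g≡h = ≡₄-refl
weighted-map₄ (w ∷ ws) (x ∷ xs) g≡h = +-cong₄ (*-congˡ₄ w (g≡h x)) (weighted-map₄ ws xs g≡h)

-- With κ ≡ Σ wt·f the balance of the old part, the enlarged set is balanced when μ κ + Σ ws·rs ≡ 0, ws and
-- rs being the new weights and the demands of the inner vertices; t must then anchor every inner vertex and
-- rebalance the old part once its ends, of old weights A and B, receive the first and the last value.
record EarArithmetic (μ A B : ℕ) (ws : List ℕ) : Set where
  constructor earArithmetic
  field
    solve : ∀ (κ : Fin 4) (rs : List (Fin 4)) → length rs ≡ length ws →
      μ * toℕ κ + weighted ws (map toℕ rs) ≡₄ 0 →
      ∃ λ (t : Fin 4) → T (anchored true (toℕ t) (map toℕ rs)) ×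
        toℕ κ + 3 * (toℕ t * A + chainEnd (toℕ t) (map toℕ rs) * B) ≡₄ 0

∀-ofLength? : ∀ {P : List (Fin 4) → Set} k → (∀ rs → Dec (P rs)) → Dec (∀ rs → length rs ≡ k → P rs)
∀-ofLength? zero P? = map′ (λ { p [] refl → p }) (λ h → h [] refl) (P? [])
∀-ofLength? (suc k) P? =
  map′ (λ { h (r ∷ rs) e → h r rs (suc-injective e) }) (λ h r rs e → h (r ∷ rs) (cong suc e))
       (FP.all? (λ r → ∀-ofLength? k (λ rs → P? (r ∷ rs))))

earArithmetic? : ∀ μ A B ws → Dec (EarArithmetic μ A B ws)
earArithmetic? μ A B ws = map′ earArithmetic EarArithmetic.solve $ FP.all? λ κ → ∀-ofLength? (length ws) λ rs →
  ((μ * toℕ κ + weighted ws (map toℕ rs)) ≡₄? 0) →-dec FP.any? λ t →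
    T? (anchored true (toℕ t) (map toℕ rs)) ×-dec
    ((toℕ κ + 3 * (toℕ t * A + chainEnd (toℕ t) (map toℕ rs) * B)) ≡₄? 0)

decided : ∀ {μ A B ws} → True (earArithmetic? μ A B ws) → EarArithmetic μ A B ws
decided = toWitness

colourWeight : Bool → ℕ
colourWeight true = 1
colourWeight false = 3

alternating : Bool → ℕ → List Bool
alternating c zero = []
alternating c (suc k) = c ∷ alternating (not c) k

nextColour : Bool → ℕ → Bool
nextColour c zero = c
nextColour c (suc k) = nextColour (not c) k

earArithmetic-general : ∀ {k} → k ≤ 3 → EarArithmetic 1 2 2 (replicate k 2)
earArithmetic-general z≤n = decided _
earArithmetic-general (s≤s z≤n) = decided _
earArithmetic-general (s≤s (s≤s z≤n)) = decided _
earArithmetic-general (s≤s (s≤s (s≤s z≤n))) = decided _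

earArithmetic-bipartite : ∀ {k} c → k ≤ 3 →
  EarArithmetic 1 (colourWeight c) (colourWeight (nextColour (not c) k)) (map colourWeight (alternating (not c) k))
earArithmetic-bipartite true z≤n = decided _
earArithmetic-bipartite false z≤n = decided _
earArithmetic-bipartite true (s≤s z≤n) = decided _
earArithmetic-bipartite false (s≤s z≤n) = decided _
earArithmetic-bipartite true (s≤s (s≤s z≤n)) = decided _
earArithmetic-bipartite false (s≤s (s≤s z≤n)) = decided _
earArithmetic-bipartite true (s≤s (s≤s (s≤s z≤n))) = decided _
earArithmetic-bipartite false (s≤s (s≤s (s≤s z≤n))) = decided _

earArithmetic-odd : ∀ {k} c → k ≤ 2 →
  EarArithmetic 2 (colourWeight c) (colourWeight (not (nextColour (not c) k))) (replicate k 2)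
earArithmetic-odd true z≤n = decided _
earArithmetic-odd false z≤n = decided _
earArithmetic-odd true (s≤s z≤n) = decided _
earArithmetic-odd false (s≤s z≤n) = decided _
earArithmetic-odd true (s≤s (s≤s z≤n)) = decided _
earArithmetic-odd false (s≤s (s≤s z≤n)) = decided _

𝟙 : Bool → ℕ
𝟙 true = 1
𝟙 false = 0

true≢false : true ≢ false
true≢false ()

_≡ᵇ_ : ∀ {n} → Fin n → Fin n → Bool
x ≡ᵇ y = does (x FP.≟ y)

≡ᵇ-refl : ∀ {n} (x : Fin n) → (x ≡ᵇ x) ≡ true
≡ᵇ-refl x = dec-true (x FP.≟ x) refl

≢⇒≡ᵇ-false : ∀ {n} {x y : Fin n} → x ≢ y → (x ≡ᵇ y) ≡ false
≢⇒≡ᵇ-false {x = x} {y} = dec-false (x FP.≟ y)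

≡ᵇ-true : ∀ {n} {x y : Fin n} → (x ≡ᵇ y) ≡ true → x ≡ y
≡ᵇ-true {x = x} {y} eq with x FP.≟ y
... | yes x≡y = x≡y

sumFin-cong : ∀ n {g h : Fin n → ℕ} → (∀ i → g i ≡ h i) → sumFin n g ≡ sumFin n h
sumFin-cong zero p = refl
sumFin-cong (suc n) p = cong₂ _+_ (p F.zero) (sumFin-cong n (λ i → p (F.suc i)))

sumFin-cong₄ : ∀ n {g h : Fin n → ℕ} → (∀ i → g i ≡₄ h i) → sumFin n g ≡₄ sumFin n h
sumFin-cong₄ zero p = ≡₄-refl
sumFin-cong₄ (suc n) p = +-cong₄ (p F.zero) (sumFin-cong₄ n (λ i → p (F.suc i)))

sumFin-zero : ∀ n {g : Fin n → ℕ} → (∀ i → g i ≡ 0) → sumFin n g ≡ 0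
sumFin-zero zero p = refl
sumFin-zero (suc n) p = cong₂ _+_ (p F.zero) (sumFin-zero n (λ i → p (F.suc i)))

sumFin-+ : ∀ n (g h : Fin n → ℕ) → sumFin n (λ i → g i + h i) ≡ sumFin n g + sumFin n h
sumFin-+ zero g h = refl
sumFin-+ (suc n) g h =
  trans (cong (g F.zero + h F.zero +_) (sumFin-+ n (λ i → g (F.suc i)) (λ i → h (F.suc i))))
        (+-interchange (g F.zero) (h F.zero) _ _)

sumFin-*ˡ : ∀ n k (g : Fin n → ℕ) → sumFin n (λ i → k * g i) ≡ k * sumFin n g
sumFin-*ˡ zero k g = sym (*-zeroʳ k)
sumFin-*ˡ (suc n) k g =
  trans (cong (k * g F.zero +_) (sumFin-*ˡ n k _)) (sym (*-distribˡ-+ k (g F.zero) _))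

sumFin-point : ∀ n (a : Fin n) (g : Fin n → ℕ) → sumFin n (λ i → 𝟙 (i ≡ᵇ a) * g i) ≡ g a
sumFin-point (suc n) F.zero g =
  trans (cong₂ _+_ (*-identityˡ (g F.zero)) (sumFin-zero n (λ _ → refl))) (+-identityʳ (g F.zero))
sumFin-point (suc n) (F.suc a) g = sumFin-point n a (λ i → g (F.suc i))

sumFin-mono-≤ : ∀ n {g h : Fin n → ℕ} → (∀ i → g i ≤ h i) → sumFin n g ≤ sumFin n h
sumFin-mono-≤ zero _ = z≤n
sumFin-mono-≤ (suc n) p = +-mono-≤ (p F.zero) (sumFin-mono-≤ n (λ i → p (F.suc i)))

sumFin-mono-< : ∀ n {g h : Fin n → ℕ} → (∀ i → g i ≤ h i) → ∀ a → g a < h a → sumFin n g < sumFin n h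
sumFin-mono-< (suc n) p F.zero lt = +-mono-<-≤ lt (sumFin-mono-≤ n (λ i → p (F.suc i)))
sumFin-mono-< (suc n) p (F.suc a) lt = +-mono-≤-< (p F.zero) (sumFin-mono-< n (λ i → p (F.suc i)) a lt)

sumFin-term-≤ : ∀ n (g : Fin n → ℕ) a → g a ≤ sumFin n g
sumFin-term-≤ (suc n) g F.zero = m≤m+n (g F.zero) _
sumFin-term-≤ (suc n) g (F.suc a) = ≤-trans (sumFin-term-≤ n (λ i → g (F.suc i)) a) (m≤n+m _ (g F.zero))

sumFin-≤1 : ∀ n {g : Fin n → ℕ} → (∀ i → g i ≤ 1) → sumFin n g ≤ n
sumFin-≤1 zero _ = z≤n
sumFin-≤1 (suc n) g≤1 = +-mono-≤ (g≤1 F.zero) (sumFin-≤1 n (λ i → g≤1 (F.suc i)))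

-- Walks and their chords

module Walks {A : Set} (R : A → A → Set) where

  -- Walks are indexed by position, which makes cutting out a stretch a matter of reindexing.
  record Walk (x y : A) : Set where
    field
      len : ℕ
      pt : ℕ → A
      start : pt 0 ≡ x
      end : pt len ≡ y
      steps : ∀ i → i < len → R (pt i) (pt (suc i))
  open Walk

  fromStar : ∀ {x y} → Star R x y → Walk x y
  fromStar {x} ε = record { len = 0 ; pt = λ _ → x ; start = refl ; end = refl ; steps = λ _ () }
  fromStar {x} (r ◅ rest) = record { len = suc (len w) ; pt = pt′ ; start = refl ; end = end w ; steps = steps′ }
    where
    w = fromStar rest
    pt′ : ℕ → A
    pt′ zero = x
    pt′ (suc i) = pt w i
    steps′ : ∀ i → i < suc (len w) → R (pt′ i) (pt′ (suc i))
    steps′ zero _ = subst (R x) (sym (start w)) r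
    steps′ (suc i) (s≤s i<len) = steps w i i<len

  truncate : ∀ {x y} (w : Walk x y) i → i ≤ len w → pt w i ≡ y → Walk x y
  truncate w i i≤len ptᵢ≡y = record
    { len = i ; pt = pt w ; start = start w ; end = ptᵢ≡y ; steps = λ k k<i → steps w k (<-≤-trans k<i i≤len) }

  bypass : ∀ {x y} (w : Walk x y) i g L' → L' + g ≡ len w → i < L' → R (pt w i) (pt w (suc (i + g))) →
    Σ (Walk x y) λ w' → len w' ≡ L'
  bypass {x} {y} w i g L' L'+g≡len i<L' jump =
    record { len = L' ; pt = pt′ ; start = start w ; end = end′ ; steps = steps′ } , refl
    where
    pt′ : ℕ → A
    pt′ k with k ≤? i
    ... | yes _ = pt w k
    ... | no _ = pt w (k + g)
    kept : ∀ {k} → k ≤ i → pt′ k ≡ pt w k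
    kept {k} k≤i with k ≤? i
    ... | yes _ = refl
    ... | no k≰i = ⊥-elim (k≰i k≤i)
    shifted : ∀ {k} → i < k → pt′ k ≡ pt w (k + g)
    shifted {k} i<k with k ≤? i
    ... | yes k≤i = ⊥-elim (<⇒≱ i<k k≤i)
    ... | no _ = refl
    end′ : pt′ L' ≡ y
    end′ = trans (shifted i<L') (trans (cong (pt w) L'+g≡len) (end w))
    steps′ : ∀ k → k < L' → R (pt′ k) (pt′ (suc k))
    steps′ k k<L' with <-cmp k i
    ... | tri< k<i _ _ = subst₂ R (sym (kept (<⇒≤ k<i))) (sym (kept k<i))
                           (steps w k (<-≤-trans k<L' (subst (L' ≤_) L'+g≡len (m≤m+n L' g))))
    ... | tri≈ _ refl _ = subst₂ R (sym (kept ≤-refl)) (sym (shifted (n<1+n k))) jump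
    ... | tri> _ _ i<k = subst₂ R (sym (shifted i<k)) (sym (shifted (m<n⇒m<1+n i<k)))
                           (steps w (k + g) (subst (k + g <_) L'+g≡len (+-monoˡ-< g k<L')))

  Chord : ∀ {x y} → Walk x y → ℕ → ℕ → Set
  Chord w i j = i + 2 ≤ j × j ≤ len w × (R (pt w i) (pt w j) ⊎ pt w i ≡ pt w j)

  Chordless : ∀ {x y} → Walk x y → Set
  Chordless w = ∀ i j → ¬ Chord w i j

  shorten : ∀ {x y} (w : Walk x y) {i j} → Chord w i j → Σ (Walk x y) λ w' → len w' < len w
  shorten {x} {y} w {i} {j} (i+2≤j , j≤len , link) with m≤n⇒∃[o]m+o≡n i+2≤j | m≤n⇒∃[o]m+o≡n j≤len
  ... | d , i+2+d≡j | r , j+r≡len = via link r j+r≡len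
    where
    bypass-shorter : ∀ g L' → L' + suc g ≡ len w → i < L' → R (pt w i) (pt w (suc (i + suc g))) →
      Σ (Walk x y) λ w' → len w' < len w
    bypass-shorter g L' L'+g≡len i<L' jump with bypass w i (suc g) L' L'+g≡len i<L' jump
    ... | w' , refl = w' , subst (L' <_) L'+g≡len (m<m+n L' (s≤s z≤n))

    via : R (pt w i) (pt w j) ⊎ pt w i ≡ pt w j → ∀ r → j + r ≡ len w → Σ (Walk x y) λ w' → len w' < len w
    via (inj₁ chord) r j+r≡len =
      bypass-shorter d (i + 1 + r) (trans (chord-length i d r) (trans (cong (_+ r) i+2+d≡j) j+r≡len))
        (<-≤-trans (m<m+n i (s≤s z≤n)) (m≤m+n (i + 1) r))
        (subst (R (pt w i) ∘ pt w) (sym (trans (chord-jump i d) i+2+d≡j)) chord)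
      where
      chord-length : ∀ i d r → i + 1 + r + suc d ≡ i + 2 + d + r
      chord-length = solve-∀
      chord-jump : ∀ i d → suc (i + suc d) ≡ i + 2 + d
      chord-jump = solve-∀
    via (inj₂ repeat) zero j≡len =
      truncate w i (<⇒≤ (<-≤-trans i<j j≤len)) (trans repeat (trans (cong (pt w) j≡len′) (end w))) ,
      <-≤-trans i<j j≤len
      where
      j≡len′ = trans (sym (+-identityʳ j)) j≡len
      i<j = <-≤-trans (m<m+n i (s≤s z≤n)) i+2≤j
    via (inj₂ repeat) (suc r) j+r≡len =
      bypass-shorter (suc d) (i + suc r) (trans (loop-length i d r) (trans (cong (_+ suc r) i+2+d≡j) j+r≡len))
        (m<m+n i (s≤s z≤n))
        (subst₂ R (sym repeat) (cong (pt w) (sym (trans (loop-jump i d) (cong suc i+2+d≡j))))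
                  (steps w j (subst (j <_) j+r≡len (m<m+n j (s≤s z≤n)))))
      where
      loop-length : ∀ i d r → i + suc r + suc (suc d) ≡ i + 2 + d + suc r
      loop-length = solve-∀
      loop-jump : ∀ i d → suc (i + suc (suc d)) ≡ suc (i + 2 + d)
      loop-jump = solve-∀

  module _ (R? : Decidable R) (_≟_ : DecidableEquality A) where

    chord? : ∀ {x y} (w : Walk x y) i j → Dec (Chord w i j)
    chord? w i j = (i + 2 ≤? j) ×-dec (j ≤? len w) ×-dec (R? (pt w i) (pt w j) ⊎-dec (pt w i ≟ pt w j))

    findChord : ∀ {x y} (w : Walk x y) → Chordless w ⊎ ∃ λ i → ∃ λ j → Chord w i j
    findChord w with anyUpTo? (λ j → anyUpTo? (λ i → chord? w i j) j) (suc (len w))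
    ... | yes (j , _ , i , _ , chord) = inj₂ (i , j , chord)
    ... | no none = inj₁ λ i j chord@(i+2≤j , j≤len , _) →
      none (j , s≤s j≤len , i , <-≤-trans (m<m+n i (s≤s z≤n)) i+2≤j , chord)

    chordless : ∀ {x y} → Walk x y → Σ (Walk x y) Chordless
    chordless w = go w (<-wellFounded (len w))
      where
      go : ∀ {x y} (w : Walk x y) → Acc _<_ (len w) → Σ (Walk x y) Chordless
      go w (acc smaller) with findChord w
      ... | inj₁ none = w , none
      ... | inj₂ (_ , _ , chord) with shorten w chord
      ...   | w' , shorter = go w' (smaller shorter)

module _ {n : ℕ} (G : SimpleGraph n) where

  open import Data.List.Membership.DecPropositional (FP._≟_ {n}) using (_∈_; _∉_; _∈?_)

  -- Factors on a growing vertex set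

  VertexSet : Set
  VertexSet = Fin n → Bool

  EdgeSet : Set
  EdgeSet = Fin n → Fin n → Bool

  EdgeWeights : Set
  EdgeWeights = Fin n → Fin n → ℕ

  infix 4 _⊆_
  _⊆_ : VertexSet → VertexSet → Set
  S ⊆ S' = ∀ v → S v ≡ true → S' v ≡ true

  degree : EdgeWeights → Fin n → ℕ
  degree X v = sumFin n (λ w → 𝟙 (adj G v w) * X v w)

  Live : EdgeWeights → Fin n → Fin n → Set
  Live X u v = Adj G u v × ¬ (X u v ≡₄ 0)

  Balanced : (wt f : Fin n → ℕ) → Set
  Balanced wt f = sumFin n (λ v → wt v * f v) ≡₄ 0

  record Factor (S : VertexSet) (q : EdgeSet) (f : Fin n → ℕ) : Set where
    field
      weight : EdgeWeights
      symmetric : ∀ u v → weight u v ≡ weight v u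
      supported : ∀ u v → q u v ≡ false → weight u v ≡₄ 0
      degrees : ∀ v → S v ≡ true → degree weight v ≡₄ f v
      connects : ∀ u v → S u ≡ true → S v ≡ true → Star (Live weight) u v

  Solvable : VertexSet → EdgeSet → (Fin n → ℕ) → Set
  Solvable S q wt = ∀ f → Balanced wt f → Factor S q f

  Reaches : VertexSet → EdgeWeights → Fin n → Set
  Reaches S X v = ∃ λ s → S s ≡ true × Star (Live X) v s

  record Patch (S S' : VertexSet) (q q' : EdgeSet) (wt f : Fin n → ℕ) (Y : EdgeWeights) : Set where
    field
      symmetric : ∀ u v → Y u v ≡ Y v u
      off-old : ∀ u v → q u v ≡ true → Y u v ≡ 0
      within-new : ∀ u v → q' u v ≡ false → Y u v ≡ 0
      degrees-new : ∀ v → S' v ≡ true → S v ≡ false → degree Y v ≡₄ f v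
      rebalances : Balanced wt (λ v → f v + 3 * degree Y v)
      anchors : ∀ v → S' v ≡ true → S v ≡ false → Reaches S Y v

  degree-+ : ∀ (X Y : EdgeWeights) v → degree (λ a b → X a b + Y a b) v ≡ degree X v + degree Y v
  degree-+ X Y v =
    trans (sumFin-cong n (λ w → *-distribˡ-+ (𝟙 (adj G v w)) (X v w) (Y v w))) (sumFin-+ n _ _)

  degree-≡₄0 : ∀ (X : EdgeWeights) v → (∀ w → X v w ≡₄ 0) → degree X v ≡₄ 0
  degree-≡₄0 X v X≡0 = ≡₄-trans (sumFin-cong₄ n (λ w → *-congˡ₄ (𝟙 (adj G v w)) (X≡0 w)))
                                 (≡⇒≡₄ (sumFin-zero n (λ w → *-zeroʳ (𝟙 (adj G v w)))))

  Adj-sym : ∀ {x y} → Adj G x y → Adj G y x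
  Adj-sym {x} {y} xy = trans (SimpleGraph.sym G y x) xy

  Live-cong : ∀ {X Z : EdgeWeights} {u v} → X u v ≡₄ Z u v → Live X u v → Live Z u v
  Live-cong X≡Z (uv , X≢0) = uv , λ Z≡0 → X≢0 (≡₄-trans X≡Z Z≡0)

  Live-sym : ∀ {X : EdgeWeights} → (∀ u v → X u v ≡ X v u) → ∀ {u v} → Live X u v → Live X v u
  Live-sym {X} sym-X {u} {v} (uv , X≢0) =
    Adj-sym uv , λ X≡0 → X≢0 (≡₄-trans (≡⇒≡₄ (sym-X u v)) X≡0)

  -- A patch Y supported on the new edges shifts the demand on the old part to f + 3·deg Y ≡ f − deg Y;
  -- a factor for the shifted demand plus Y is then a factor on the larger set.
  extendSolvable : ∀ {S S' q q' wt wt'} → S ⊆ S' → (∀ u v → q u v ≡ true → q' u v ≡ true) →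
    (∀ u v → q u v ≡ true → S u ≡ true) → Solvable S q wt →
    (∀ f → Balanced wt' f → ∃ (Patch S S' q q' wt f)) → Solvable S' q' wt'
  extendSolvable {S} {S'} {q} {q'} {wt} S⊆S' q⊆q' q⊆S solve patch f bal = record
    { weight = X ; symmetric = symmetric ; supported = supported ; degrees = degrees ; connects = connects }
    where
    Y = proj₁ (patch f bal)
    open Patch (proj₂ (patch f bal)) using (off-old; within-new; degrees-new; rebalances; anchors)
      renaming (symmetric to Y-symmetric)
    old = solve (λ v → f v + 3 * degree Y v) rebalances
    open Factor old using () renaming (weight to X₀; symmetric to X₀-symmetric; supported to X₀-supported)

    X : EdgeWeights
    X u v = X₀ u v + Y u v

    q-false : ∀ u v → q' u v ≡ false → q u v ≡ false
    q-false u v q'uv with q u v in quv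
    ... | true = ⊥-elim (true≢false (trans (sym (q⊆q' u v quv)) q'uv))
    ... | false = refl

    outside-old : ∀ u v → S u ≡ false → q u v ≡ false
    outside-old u v Su with q u v in quv
    ... | true = ⊥-elim (true≢false (trans (sym (q⊆S u v quv)) Su))
    ... | false = refl

    symmetric : ∀ u v → X u v ≡ X v u
    symmetric u v = cong₂ _+_ (X₀-symmetric u v) (Y-symmetric u v)

    supported : ∀ u v → q' u v ≡ false → X u v ≡₄ 0
    supported u v q'uv = +-cong₄ (X₀-supported u v (q-false u v q'uv)) (≡⇒≡₄ (within-new u v q'uv))

    degrees : ∀ v → S' v ≡ true → degree X v ≡₄ f v
    degrees v S'v with S v in Sv
    ... | true = begin
      degree X v                                   ≡⟨ degree-+ X₀ Y v ⟩
      degree X₀ v + degree Y v                     ≈⟨ +-cong₄ (Factor.degrees old v Sv) ≡₄-refl ⟩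
      f v + 3 * degree Y v + degree Y v            ≈⟨ +-3*-+-≡₄ (f v) (degree Y v) ⟩
      f v                                          ∎
      where open ≡₄-Reasoning
    ... | false = begin
      degree X v                ≡⟨ degree-+ X₀ Y v ⟩
      degree X₀ v + degree Y v  ≈⟨ +-cong₄ (degree-≡₄0 X₀ v λ w → X₀-supported v w (outside-old v w Sv))
                                           ≡₄-refl ⟩
      degree Y v                ≈⟨ degrees-new v S'v Sv ⟩
      f v                       ∎
      where open ≡₄-Reasoning

    old-live : ∀ {u v} → Live X₀ u v → Live X u v
    old-live {u} {v} live₀ with q u v in quv
    ... | true = Live-cong {X₀} {X} (≡⇒≡₄ (sym (trans (cong (X₀ u v +_) (off-old u v quv)) (+-identityʳ _)))) live₀
    ... | false = ⊥-elim (proj₂ live₀ (X₀-supported u v quv))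

    patch-live : ∀ {u v} → Live Y u v → Live X u v
    patch-live {u} {v} liveY with q u v in quv
    ... | true = ⊥-elim (proj₂ liveY (≡⇒≡₄ (off-old u v quv)))
    ... | false = Live-cong {Y} {X} (≡₄-sym (+-cong₄ (X₀-supported u v quv) ≡₄-refl)) liveY

    reaches-old : ∀ u → S' u ≡ true → Reaches S X u
    reaches-old u S'u with S u in Su
    ... | true = u , Su , ε
    ... | false with anchors u S'u Su
    ...   | s , Ss , walk = s , Ss , Star.map patch-live walk

    connects : ∀ u v → S' u ≡ true → S' v ≡ true → Star (Live X) u v
    connects u v S'u S'v with reaches-old u S'u | reaches-old v S'v
    ... | s , Ss , u→s | s' , Ss' , v→s' =
      u→s ◅◅ Star.map old-live (Factor.connects old s s' Ss Ss') ◅◅ Star.reverse (Live-sym symmetric) v→s'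

  degree-*ˡ : ∀ c (X : EdgeWeights) v → degree (λ a b → c * X a b) v ≡ c * degree X v
  degree-*ˡ c X v = trans (sumFin-cong n (λ w → swap (𝟙 (adj G v w)) c (X v w))) (sumFin-*ˡ n c _)
    where swap : ∀ a b d → a * (b * d) ≡ b * (a * d)
          swap = solve-∀

  WEdge : Set
  WEdge = ℕ × Fin n × Fin n

  ends : WEdge → Fin n × Fin n
  ends = proj₂

  unit : Fin n → Fin n → EdgeWeights
  unit x y u v = 𝟙 ((u ≡ᵇ x) ∧ (v ≡ᵇ y)) + 𝟙 ((u ≡ᵇ y) ∧ (v ≡ᵇ x))

  weights : List WEdge → EdgeWeights
  weights [] u v = 0
  weights ((c , x , y) ∷ L) u v = c * unit x y u v + weights L u v

  incidence : List WEdge → Fin n → ℕ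
  incidence [] v = 0
  incidence ((c , x , y) ∷ L) v = c * (𝟙 (v ≡ᵇ x) + 𝟙 (v ≡ᵇ y)) + incidence L v

  load : (Fin n → ℕ) → List WEdge → ℕ
  load wt [] = 0
  load wt ((c , x , y) ∷ L) = c * (wt x + wt y) + load wt L

  Apart : Fin n × Fin n → Fin n × Fin n → Set
  Apart (x , y) (u , v) = ¬ (u ≡ x × v ≡ y) × ¬ (u ≡ y × v ≡ x)

  Avoids : Fin n → Fin n × Fin n → Set
  Avoids v (x , y) = v ≢ x × v ≢ y

  Avoids⇒Apart : ∀ {x p e} → Avoids p e → Apart (x , p) e
  Avoids⇒Apart (p≢u , p≢w) = (λ (_ , w≡p) → p≢w (sym w≡p)) , (λ (u≡p , _) → p≢u (sym u≡p))

  Apart-sym : ∀ {e e'} → Apart e e' → Apart e' e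
  Apart-sym (≢xy , ≢yx) =
    (λ (x≡u , y≡v) → ≢xy (sym x≡u , sym y≡v)) , (λ (x≡v , y≡u) → ≢yx (sym y≡u , sym x≡v))

  unit-sym : ∀ x y u v → unit x y u v ≡ unit x y v u
  unit-sym x y u v = trans (+-comm (𝟙 ((u ≡ᵇ x) ∧ (v ≡ᵇ y))) (𝟙 ((u ≡ᵇ y) ∧ (v ≡ᵇ x))))
    (cong₂ _+_ (cong 𝟙 (∧-comm (u ≡ᵇ y) (v ≡ᵇ x))) (cong 𝟙 (∧-comm (u ≡ᵇ x) (v ≡ᵇ y))))

  𝟙-∧-false : ∀ {a b} → ¬ (a ≡ true × b ≡ true) → 𝟙 (a ∧ b) ≡ 0
  𝟙-∧-false {true} {true} ¬both = ⊥-elim (¬both (refl , refl))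
  𝟙-∧-false {true} {false} _ = refl
  𝟙-∧-false {false} _ = refl

  unit-apart : ∀ {x y u v} → Apart (x , y) (u , v) → unit x y u v ≡ 0
  unit-apart (≢xy , ≢yx) = cong₂ _+_ (𝟙-∧-false λ (p , q) → ≢xy (≡ᵇ-true p , ≡ᵇ-true q))
                                    (𝟙-∧-false λ (p , q) → ≢yx (≡ᵇ-true p , ≡ᵇ-true q))

  unit-self : ∀ {x y} → x ≢ y → unit x y x y ≡ 1
  unit-self {x} {y} x≢y rewrite ≡ᵇ-refl x | ≡ᵇ-refl y | ≢⇒≡ᵇ-false x≢y = refl

  weights-sym : ∀ L u v → weights L u v ≡ weights L v u
  weights-sym [] u v = refl
  weights-sym ((c , x , y) ∷ L) u v = cong₂ _+_ (cong (c *_) (unit-sym x y u v)) (weights-sym L u v)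

  weights-apart : ∀ {L u v} → All (λ e → Apart (ends e) (u , v)) L → weights L u v ≡ 0
  weights-apart [] = refl
  weights-apart {(c , _ , _) ∷ _} (apart ∷ aparts) =
    cong₂ _+_ (trans (cong (c *_) (unit-apart apart)) (*-zeroʳ c)) (weights-apart aparts)

  weights-separated : (R : Fin n → Fin n → Set) → (∀ {x y} → R x y → R y x) →
    ∀ {L u v} → ¬ R u v → All (λ (_ , x , y) → R x y) L → weights L u v ≡ 0
  weights-separated R R-sym ¬Ruv Rs =
    weights-apart (All.map (λ Rxy → (λ { (refl , refl) → ¬Ruv Rxy }) , (λ { (refl , refl) → ¬Ruv (R-sym Rxy) })) Rs)

  weights-at : ∀ {L} → All (λ (_ , x , y) → x ≢ y) L → AllPairs (Apart on ends) L →
    All (λ (c , x , y) → weights L x y ≡ c) L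
  weights-at [] [] = []
  weights-at {(c , x , y) ∷ L} (x≢y ∷ loopless) (aparts ∷ pairwise) =
    at-head ∷ All.zipWith at-later (aparts , weights-at loopless pairwise)
    where
    at-head : c * unit x y x y + weights L x y ≡ c
    at-head = begin
      c * unit x y x y + weights L x y
        ≡⟨ cong₂ (λ a b → c * a + b) (unit-self x≢y) (weights-apart (All.map Apart-sym aparts)) ⟩
      c * 1 + 0                       ≡⟨ trans (+-identityʳ _) (*-identityʳ c) ⟩
      c                               ∎
      where open ≡-Reasoning
    at-later : ∀ {e : WEdge} → let (c' , u , v) = e in
      Apart (x , y) (u , v) × weights L u v ≡ c' → c * unit x y u v + weights L u v ≡ c'
    at-later {_ , u , v} (apart , value) =
      trans (cong (λ a → a + weights L u v) (trans (cong (c *_) (unit-apart apart)) (*-zeroʳ c))) value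

  𝟙-∧ : ∀ a b → 𝟙 (a ∧ b) ≡ 𝟙 a * 𝟙 b
  𝟙-∧ true b = sym (+-identityʳ (𝟙 b))
  𝟙-∧ false b = refl

  degree-unit : ∀ {x y} → Adj G x y → ∀ v → degree (unit x y) v ≡ 𝟙 (v ≡ᵇ x) + 𝟙 (v ≡ᵇ y)
  degree-unit {x} {y} xy v = begin
    sumFin n (λ w → a w * unit x y v w)
      ≡⟨ sumFin-cong n split ⟩
    sumFin n (λ w → 𝟙 (v ≡ᵇ x) * (𝟙 (w ≡ᵇ y) * a w) + 𝟙 (v ≡ᵇ y) * (𝟙 (w ≡ᵇ x) * a w))
      ≡⟨ sumFin-+ n _ _ ⟩
    sumFin n (λ w → 𝟙 (v ≡ᵇ x) * (𝟙 (w ≡ᵇ y) * a w)) + sumFin n (λ w → 𝟙 (v ≡ᵇ y) * (𝟙 (w ≡ᵇ x) * a w))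
      ≡⟨ cong₂ _+_ (trans (sumFin-*ˡ n (𝟙 (v ≡ᵇ x)) _) (cong (𝟙 (v ≡ᵇ x) *_) (sumFin-point n y a)))
                   (trans (sumFin-*ˡ n (𝟙 (v ≡ᵇ y)) _) (cong (𝟙 (v ≡ᵇ y) *_) (sumFin-point n x a))) ⟩
    𝟙 (v ≡ᵇ x) * a y + 𝟙 (v ≡ᵇ y) * a x
      ≡⟨ cong₂ _+_ (at-endpoint xy) (at-endpoint (Adj-sym xy)) ⟩
    𝟙 (v ≡ᵇ x) + 𝟙 (v ≡ᵇ y) ∎
    where
    open ≡-Reasoning
    a : Fin n → ℕ
    a w = 𝟙 (adj G v w)
    rearrange : ∀ a b c d e → a * (b * c + d * e) ≡ b * (c * a) + d * (e * a)
    rearrange = solve-∀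
    split : ∀ w → a w * unit x y v w ≡ 𝟙 (v ≡ᵇ x) * (𝟙 (w ≡ᵇ y) * a w) + 𝟙 (v ≡ᵇ y) * (𝟙 (w ≡ᵇ x) * a w)
    split w = trans (cong₂ (λ p q → a w * (p + q)) (𝟙-∧ (v ≡ᵇ x) (w ≡ᵇ y)) (𝟙-∧ (v ≡ᵇ y) (w ≡ᵇ x)))
                    (rearrange (a w) (𝟙 (v ≡ᵇ x)) (𝟙 (w ≡ᵇ y)) (𝟙 (v ≡ᵇ y)) (𝟙 (w ≡ᵇ x)))
    at-endpoint : ∀ {p q} → Adj G p q → 𝟙 (v ≡ᵇ p) * a q ≡ 𝟙 (v ≡ᵇ p)
    at-endpoint {p} pq with v FP.≟ p
    ... | yes refl = trans (+-identityʳ _) (cong 𝟙 pq)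
    ... | no _ = refl

  degree-weights : ∀ {L} → All (λ (_ , x , y) → Adj G x y) L → ∀ v → degree (weights L) v ≡ incidence L v
  degree-weights [] v = sumFin-zero n (λ w → *-zeroʳ (𝟙 (adj G v w)))
  degree-weights {(c , x , y) ∷ L} (xy ∷ adjacent) v = begin
    degree (λ u w → c * unit x y u w + weights L u w) v
      ≡⟨ degree-+ (λ u w → c * unit x y u w) (weights L) v ⟩
    degree (λ u w → c * unit x y u w) v + degree (weights L) v
      ≡⟨ cong₂ _+_ (trans (degree-*ˡ c (unit x y) v) (cong (c *_) (degree-unit xy v))) (degree-weights adjacent v) ⟩
    c * (𝟙 (v ≡ᵇ x) + 𝟙 (v ≡ᵇ y)) + incidence L v ∎
    where open ≡-Reasoning

  incidence-avoid : ∀ {L v} → All (Avoids v ∘ ends) L → incidence L v ≡ 0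
  incidence-avoid [] = refl
  incidence-avoid {(c , x , y) ∷ L} {v} ((v≢x , v≢y) ∷ avoid)
    rewrite ≢⇒≡ᵇ-false v≢x | ≢⇒≡ᵇ-false v≢y = trans (cong (_+ incidence L v) (*-zeroʳ c)) (incidence-avoid avoid)

  sumFin-incidence : ∀ (wt : Fin n → ℕ) L → sumFin n (λ v → wt v * incidence L v) ≡ load wt L
  sumFin-incidence wt [] = sumFin-zero n (λ v → *-zeroʳ (wt v))
  sumFin-incidence wt ((c , x , y) ∷ L) = begin
    sumFin n (λ v → wt v * (c * (𝟙 (v ≡ᵇ x) + 𝟙 (v ≡ᵇ y)) + incidence L v))
      ≡⟨ sumFin-cong n (λ v → rearrange (wt v) c (𝟙 (v ≡ᵇ x)) (𝟙 (v ≡ᵇ y)) (incidence L v)) ⟩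
    sumFin n (λ v → (c * (𝟙 (v ≡ᵇ x) * wt v) + c * (𝟙 (v ≡ᵇ y) * wt v)) + wt v * incidence L v)
      ≡⟨ trans (sumFin-+ n _ _) (cong₂ _+_ (sumFin-+ n _ _) (sumFin-incidence wt L)) ⟩
    sumFin n (λ v → c * (𝟙 (v ≡ᵇ x) * wt v)) + sumFin n (λ v → c * (𝟙 (v ≡ᵇ y) * wt v)) + load wt L
      ≡⟨ cong (_+ load wt L) (cong₂ _+_ (trans (sumFin-*ˡ n c _) (cong (c *_) (sumFin-point n x wt)))
                                        (trans (sumFin-*ˡ n c _) (cong (c *_) (sumFin-point n y wt)))) ⟩
    c * wt x + c * wt y + load wt L
      ≡⟨ cong (_+ load wt L) (sym (*-distribˡ-+ c (wt x) (wt y))) ⟩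
    c * (wt x + wt y) + load wt L ∎
    where
    open ≡-Reasoning
    rearrange : ∀ w c a b d → w * (c * (a + b) + d) ≡ (c * (a * w) + c * (b * w)) + w * d
    rearrange = solve-∀

  balance-shift : ∀ (wt f : Fin n → ℕ) {L} → All (λ (_ , x , y) → Adj G x y) L →
    sumFin n (λ v → wt v * (f v + 3 * degree (weights L) v)) ≡ sumFin n (λ v → wt v * f v) + 3 * load wt L
  balance-shift wt f {L} adjacent = begin
    sumFin n (λ v → wt v * (f v + 3 * degree (weights L) v))
      ≡⟨ sumFin-cong n (λ v → distribute (wt v) (f v) (degree (weights L) v)) ⟩
    sumFin n (λ v → wt v * f v + 3 * (wt v * degree (weights L) v))
      ≡⟨ trans (sumFin-+ n _ _) (cong (sumFin n (λ v → wt v * f v) +_) (sumFin-*ˡ n 3 _)) ⟩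
    sumFin n (λ v → wt v * f v) + 3 * sumFin n (λ v → wt v * degree (weights L) v)
      ≡⟨ cong (λ x → sumFin n (λ v → wt v * f v) + 3 * x)
              (trans (sumFin-cong n (λ v → cong (wt v *_) (degree-weights adjacent v))) (sumFin-incidence wt L)) ⟩
    sumFin n (λ v → wt v * f v) + 3 * load wt L ∎
    where
    open ≡-Reasoning
    distribute : ∀ w x d → w * (x + 3 * d) ≡ w * x + 3 * (w * d)
    distribute = solve-∀

  pathEdges : Fin n → List (Fin n) → Fin n → List (Fin n × Fin n)
  pathEdges x [] b = (x , b) ∷ []
  pathEdges x (p ∷ ps) b = (x , p) ∷ pathEdges p ps b

  earEdges : (Fin n → ℕ) → ℕ → Fin n → List (Fin n) → Fin n → List WEdge
  earEdges r t x [] b = (t , x , b) ∷ []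
  earEdges r t x (p ∷ ps) b = (t , x , p) ∷ earEdges r (r p + 3 * t) p ps b

  pathEdges⇒earEdges : ∀ {P : Fin n × Fin n → Set} {r t x ps b} →
    All P (pathEdges x ps b) → All (P ∘ ends) (earEdges r t x ps b)
  pathEdges⇒earEdges {ps = []} (Pxb ∷ []) = Pxb ∷ []
  pathEdges⇒earEdges {ps = p ∷ ps} (Pxp ∷ Ps) = Pxp ∷ pathEdges⇒earEdges Ps

  pathEdges⇒earEdges-pairs : ∀ {R : Fin n × Fin n → Fin n × Fin n → Set} {r t x ps b} →
    AllPairs R (pathEdges x ps b) → AllPairs (R on ends) (earEdges r t x ps b)
  pathEdges⇒earEdges-pairs {ps = []} (_ ∷ []) = [] ∷ []
  pathEdges⇒earEdges-pairs {ps = p ∷ ps} (Rs ∷ pairs) = pathEdges⇒earEdges Rs ∷ pathEdges⇒earEdges-pairs pairs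

  pathEdges-avoid : ∀ {v x ps b} → v ≢ x → All (v ≢_) ps → v ≢ b → All (Avoids v) (pathEdges x ps b)
  pathEdges-avoid {ps = []} v≢x [] v≢b = (v≢x , v≢b) ∷ []
  pathEdges-avoid {ps = p ∷ ps} v≢x (v≢p ∷ v∉ps) v≢b = (v≢x , v≢p) ∷ pathEdges-avoid v≢p v∉ps v≢b

  -- An ear with a single inner vertex must have distinct ends, or its two edges would coincide.
  EndsApart : Fin n → List (Fin n) → Fin n → Set
  EndsApart x (_ ∷ []) b = x ≢ b
  EndsApart x _ b = ⊤

  ≢⇒EndsApart : ∀ {x b} ps → x ≢ b → EndsApart x ps b
  ≢⇒EndsApart [] x≢b = _
  ≢⇒EndsApart (_ ∷ []) x≢b = x≢b
  ≢⇒EndsApart (_ ∷ _ ∷ _) x≢b = _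

  pathEdges-apart : ∀ {x ps b} → All (x ≢_) ps → Unique ps → All (_≢ b) ps → EndsApart x ps b →
    AllPairs Apart (pathEdges x ps b)
  pathEdges-apart {ps = []} _ _ _ _ = [] ∷ []
  pathEdges-apart {x} {p ∷ ps} {b} (x≢p ∷ x∉ps) (p∉ps ∷ unique) (p≢b ∷ ps≢b) ends-apart =
    first-apart ps x∉ps p∉ps p≢b ends-apart ∷ pathEdges-apart p∉ps unique ps≢b (≢⇒EndsApart ps p≢b)
    where
    first-apart : ∀ ps → All (x ≢_) ps → All (p ≢_) ps → p ≢ b → EndsApart x (p ∷ ps) b →
      All (Apart (x , p)) (pathEdges p ps b)
    first-apart [] _ _ _ x≢b = ((λ (p≡x , _) → x≢p (sym p≡x)) , (λ (_ , b≡x) → x≢b (sym b≡x))) ∷ []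
    first-apart (q ∷ qs) (x≢q ∷ _) (p≢q ∷ p∉qs) p≢b _ =
      ((λ (p≡x , _) → x≢p (sym p≡x)) , (λ (_ , q≡x) → x≢q (sym q≡x))) ∷
      All.map Avoids⇒Apart (pathEdges-avoid p≢q p∉qs p≢b)

  incidence-start : ∀ {r t x ps b} → All (x ≢_) ps → x ≢ b → incidence (earEdges r t x ps b) x ≡ t
  incidence-start {t = t} {x} {[]} {b} [] x≢b rewrite ≡ᵇ-refl x | ≢⇒≡ᵇ-false x≢b = trans (+-identityʳ _) (*-identityʳ t)
  incidence-start {r} {t} {x} {p ∷ ps} {b} (x≢p ∷ x∉ps) x≢b rewrite ≡ᵇ-refl x | ≢⇒≡ᵇ-false x≢p =
    trans (cong₂ _+_ (*-identityʳ t) (incidence-avoid (pathEdges⇒earEdges (pathEdges-avoid x≢p x∉ps x≢b)))) (+-identityʳ t)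

  incidence-inner : ∀ {r t x ps b} → Unique ps → All (x ≢_) ps → All (_≢ b) ps →
    ∀ {p} → p ∈ ps → incidence (earEdges r t x ps b) p ≡₄ r p
  incidence-inner {r} {t} {x} {q ∷ qs} {b} (q∉qs ∷ _) (x≢q ∷ _) (q≢b ∷ _) (here refl)
    rewrite ≢⇒≡ᵇ-false (x≢q ∘ sym) | ≡ᵇ-refl q | incidence-start {r} {r q + 3 * t} {q} {qs} {b} q∉qs q≢b =
    ≡₄-trans (≡⇒≡₄ (shuffle t (r q))) (+-3*-+-≡₄ (r q) t)
    where shuffle : ∀ t r → t * (0 + 1) + (r + 3 * t) ≡ r + 3 * t + t
          shuffle = solve-∀
  incidence-inner {r} {t} {x} {q ∷ qs} {b} (q∉qs ∷ unique) (x≢q ∷ x∉qs) (q≢b ∷ qs≢b) {p} (there p∈qs)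
    rewrite ≢⇒≡ᵇ-false (All.lookup x∉qs p∈qs ∘ sym) | ≢⇒≡ᵇ-false (All.lookup q∉qs p∈qs ∘ sym) =
    ≡₄-trans (≡⇒≡₄ (cong (_+ incidence (earEdges r (r q + 3 * t) q qs b) p) (*-zeroʳ t)))
             (incidence-inner unique q∉qs qs≢b p∈qs)

  load-ear : ∀ (wt : Fin n → ℕ) {r t x ps b} → All (λ p → wt p ≡ 0) ps →
    load wt (earEdges r t x ps b) ≡ t * wt x + chainEnd t (map r ps) * wt b
  load-ear wt {t = t} {x} {[]} {b} [] = trans (+-identityʳ _) (*-distribˡ-+ t (wt x) (wt b))
  load-ear wt {r} {t} {x} {p ∷ ps} {b} (wtp ∷ wts) rewrite load-ear wt {r} {r p + 3 * t} {p} {ps} {b} wts | wtp =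
    shuffle t (wt x) (r p + 3 * t) (chainEnd (r p + 3 * t) (map r ps) * wt b)
    where shuffle : ∀ t w s e → t * (w + 0) + (s * 0 + e) ≡ t * w + e
          shuffle = solve-∀

  live-≢0 : ∀ {c} → T (live c) → ¬ (c ≡₄ 0)
  live-≢0 live-c (mod4 c≡0) = toWitnessFalse live-c c≡0

  live-edge : ∀ {Y : EdgeWeights} {u v c} → Adj G u v → Y u v ≡ c → T (live c) → Live Y u v
  live-edge uv Yuv live-c = uv , λ Y≡0 → live-≢0 live-c (≡₄-trans (≡⇒≡₄ (sym Yuv)) Y≡0)

  EarValues : EdgeWeights → List WEdge → Set
  EarValues Y = All (λ (c , u , v) → Y u v ≡ c)

  live-walk : ∀ {Y r t x ps b} → EarValues Y (earEdges r t x ps b) → All (λ (u , v) → Adj G u v) (pathEdges x ps b) →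
    T (allLive t (map r ps)) → Star (Live Y) x b
  live-walk {Y} {ps = []} (Yxb ∷ []) (xb ∷ []) live-t = live-edge {Y} xb Yxb live-t ◅ ε
  live-walk {Y} {ps = p ∷ ps} (Yxp ∷ values) (xp ∷ adjacent) all-live =
    live-edge {Y} xp Yxp (proj₁ both) ◅ live-walk values adjacent (proj₂ both)
    where both = Equivalence.to T-∧ all-live

  ear-reaches : ∀ {S Y r ℓ t x ps b} → (∀ u v → Y u v ≡ Y v u) → (T ℓ → Reaches S Y x) → S b ≡ true →
    EarValues Y (earEdges r t x ps b) → All (λ (u , v) → Adj G u v) (pathEdges x ps b) →
    T (anchored ℓ t (map r ps)) → ∀ {p} → p ∈ ps → Reaches S Y p
  ear-reaches {S} {Y} {r} {ℓ} {t} {x} {q ∷ qs} {b} Y-sym x-reaches Sb (Yxq ∷ values) (xq ∷ adjacent) anchor q∈ =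
    case q∈
    where
    parts = Equivalence.to T-∧ anchor
    via-left : T (ℓ ∧ live t) → Reaches S Y q
    via-left ℓ∧live with Equivalence.to T-∧ ℓ∧live
    ... | Tℓ , live-t with x-reaches Tℓ
    ...   | s , Ss , x→s = s , Ss , Live-sym Y-sym (live-edge {Y} xq Yxq live-t) ◅ x→s
    q-reaches : Reaches S Y q
    q-reaches with Equivalence.to T-∨ (proj₁ parts)
    ... | inj₁ ℓ∧live = via-left ℓ∧live
    ... | inj₂ all-live = b , Sb , live-walk values adjacent all-live
    case : ∀ {p} → p ∈ q ∷ qs → Reaches S Y p
    case (here refl) = q-reaches
    case (there p∈qs) = ear-reaches Y-sym via-left Sb values adjacent (proj₂ parts) p∈qs

  infixl 6 _∪_
  _∪_ : VertexSet → List (Fin n) → VertexSet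
  (S ∪ ps) v = S v ∨ does (v ∈? ps)

  insertion : List (Fin n) → (Fin n → ℕ) → Fin n → ℕ
  insertion [] g v = 0
  insertion (p ∷ ps) g v = 𝟙 (v ≡ᵇ p) * g p + insertion ps g v

  sumFin-insertion : ∀ ps (g f : Fin n → ℕ) → sumFin n (λ v → insertion ps g v * f v) ≡ weighted (map g ps) (map f ps)
  sumFin-insertion [] g f = sumFin-zero n (λ _ → refl)
  sumFin-insertion (p ∷ ps) g f = begin
    sumFin n (λ v → (𝟙 (v ≡ᵇ p) * g p + insertion ps g v) * f v)
      ≡⟨ sumFin-cong n (λ v → rearrange (𝟙 (v ≡ᵇ p)) (g p) (insertion ps g v) (f v)) ⟩
    sumFin n (λ v → g p * (𝟙 (v ≡ᵇ p) * f v) + insertion ps g v * f v)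
      ≡⟨ sumFin-+ n _ _ ⟩
    sumFin n (λ v → g p * (𝟙 (v ≡ᵇ p) * f v)) + sumFin n (λ v → insertion ps g v * f v)
      ≡⟨ cong₂ _+_ (trans (sumFin-*ˡ n (g p) _) (cong (g p *_) (sumFin-point n p f))) (sumFin-insertion ps g f) ⟩
    g p * f p + weighted (map g ps) (map f ps) ∎
    where
    open ≡-Reasoning
    rearrange : ∀ i w r x → (i * w + r) * x ≡ w * (i * x) + r * x
    rearrange = solve-∀

  insertion-∉ : ∀ {ps v} (g : Fin n → ℕ) → v ∉ ps → insertion ps g v ≡ 0
  insertion-∉ {[]} g v∉ = refl
  insertion-∉ {p ∷ ps} g v∉ rewrite ≢⇒≡ᵇ-false (v∉ ∘ here) = insertion-∉ g (v∉ ∘ there)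

  insertion-∈ : ∀ {ps v} (g : Fin n → ℕ) → Unique ps → v ∈ ps → insertion ps g v ≡ g v
  insertion-∈ {p ∷ ps} g (p∉ps ∷ _) (here refl) rewrite ≡ᵇ-refl p =
    trans (cong₂ _+_ (+-identityʳ (g p)) (insertion-∉ g (λ p∈ → All.lookup p∉ps p∈ refl))) (+-identityʳ (g p))
  insertion-∈ {p ∷ ps} {v} g (p∉ps ∷ unique) (there v∈ps) rewrite ≢⇒≡ᵇ-false (All.lookup p∉ps v∈ps ∘ sym) =
    insertion-∈ g unique v∈ps

  balance-split : ∀ {ps} {wt wt' : Fin n → ℕ} μ f → (∀ v → wt' v ≡₄ μ * wt v + insertion ps wt' v) →
    Balanced wt' f → μ * sumFin n (λ v → wt v * f v) + weighted (map wt' ps) (map f ps) ≡₄ 0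
  balance-split {ps} {wt} {wt'} μ f split balanced = begin
    μ * sumFin n (λ v → wt v * f v) + weighted (map wt' ps) (map f ps)
      ≡⟨ cong (μ * sumFin n (λ v → wt v * f v) +_) (sumFin-insertion ps wt' f) ⟨
    μ * sumFin n (λ v → wt v * f v) + sumFin n (λ v → insertion ps wt' v * f v)
      ≡⟨ trans (sumFin-+ n (λ v → μ * (wt v * f v)) _) (cong (_+ _) (sumFin-*ˡ n μ (λ v → wt v * f v))) ⟨
    sumFin n (λ v → μ * (wt v * f v) + insertion ps wt' v * f v)
      ≡⟨ sumFin-cong n (λ v → distribute μ (wt v) (insertion ps wt' v) (f v)) ⟩
    sumFin n (λ v → (μ * wt v + insertion ps wt' v) * f v)
      ≈⟨ sumFin-cong₄ n (λ v → *-congʳ₄ (f v) (≡₄-sym (split v))) ⟩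
    sumFin n (λ v → wt' v * f v)
      ≈⟨ balanced ⟩
    0 ∎
    where
    open ≡₄-Reasoning
    distribute : ∀ m w i x → m * (w * x) + i * x ≡ (m * w + i) * x
    distribute = solve-∀

  ∈-∪ : ∀ {S ps v} → v ∈ ps → (S ∪ ps) v ≡ true
  ∈-∪ {S} {ps} {v} v∈ rewrite dec-true (v ∈? ps) v∈ = ∨-zeroʳ (S v)

  ⊆-∪ : ∀ {S} ps → S ⊆ S ∪ ps
  ⊆-∪ ps v Sv rewrite Sv = refl

  ∪-new : ∀ {S ps v} → (S ∪ ps) v ≡ true → S v ≡ false → v ∈ ps
  ∪-new {S} {ps} {v} S'v Sv with v ∈? ps
  ... | yes v∈ = v∈
  ... | no _ rewrite Sv = ⊥-elim (true≢false (sym S'v))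

  fresh-≢ : ∀ {S : VertexSet} {x ps} → S x ≡ true → All (λ p → S p ≡ false) ps → All (x ≢_) ps
  fresh-≢ Sx = All.map λ Sp x≡p → true≢false (trans (sym Sx) (trans (cong _ x≡p) Sp))

  fresh-∉ : ∀ {S : VertexSet} {x ps} → S x ≡ true → All (λ p → S p ≡ false) ps → x ∉ ps
  fresh-∉ Sx fresh x∈ = All.lookup (fresh-≢ Sx fresh) x∈ refl

  weight-split : ∀ {S : VertexSet} {ps} {wt wt' : Fin n → ℕ} μ → All (λ p → S p ≡ false) ps → Unique ps →
    (∀ v → S v ≡ true → wt' v ≡₄ μ * wt v) → (∀ v → S v ≡ false → wt v ≡ 0) →
    (∀ v → (S ∪ ps) v ≡ false → wt' v ≡ 0) →
    ∀ v → wt' v ≡₄ μ * wt v + insertion ps wt' v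
  weight-split {S} {ps} {wt} {wt'} μ fresh unique old off-S off-S' v with S v in Sv | v ∈? ps
  ... | true | _ = ≡₄-trans (old v Sv) (≡⇒≡₄ (sym (trans (cong (μ * wt v +_) (insertion-∉ wt' v∉)) (+-identityʳ _))))
    where v∉ = fresh-∉ Sv fresh
  ... | false | yes v∈ =
    ≡⇒≡₄ (sym (cong₂ _+_ (trans (cong (μ *_) (off-S v Sv)) (*-zeroʳ μ)) (insertion-∈ wt' unique v∈)))
  ... | false | no v∉ =
    ≡⇒≡₄ (trans (off-S' v S'v) (sym (cong₂ _+_ (trans (cong (μ *_) (off-S v Sv)) (*-zeroʳ μ)) (insertion-∉ wt' v∉))))
    where S'v : (S ∪ ps) v ≡ false
          S'v rewrite Sv | dec-false (v ∈? ps) v∉ = refl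

  Adj⇒≢ : ∀ {x y} → Adj G x y → x ≢ y
  Adj⇒≢ {x} xy refl = true≢false (trans (sym xy) (SimpleGraph.loopless G x))

  record Ear (S : VertexSet) : Set where
    field
      left right : Fin n
      inner : List (Fin n)
      path : All (λ (u , v) → Adj G u v) (pathEdges left inner right)
      left∈S : S left ≡ true
      right∈S : S right ≡ true
      inner∉S : All (λ p → S p ≡ false) inner
      inner-unique : Unique inner
      ends-apart : EndsApart left inner right

  module _ {S : VertexSet} (ear : Ear S) where
    open Ear ear

    earPatch : ∀ {q q' : EdgeSet} {wt wt' : Fin n → ℕ} {μ} →
      (∀ u v → q u v ≡ q v u) → (∀ u v → q' u v ≡ q' v u) →
      All (λ (u , v) → q u v ≡ false) (pathEdges left inner right) →
      All (λ (u , v) → q' u v ≡ true) (pathEdges left inner right) →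
      (∀ v → S v ≡ false → wt v ≡ 0) → (∀ v → wt' v ≡₄ μ * wt v + insertion inner wt' v) →
      EarArithmetic μ (wt left) (wt right) (map wt' inner) →
      ∀ f → Balanced wt' f → ∃ (Patch S (S ∪ inner) q q' wt f)
    earPatch {q} {q'} {wt} {wt'} {μ} q-sym q'-sym old-free new-edges off-S split arithmetic f balanced =
      Y , record
        { symmetric = weights-sym L
        ; off-old = λ u v quv → weights-separated (λ x y → q x y ≡ false) (λ {x} {y} qxy → trans (q-sym y x) qxy)
                                  (λ q≡f → true≢false (trans (sym quv) q≡f)) (pathEdges⇒earEdges old-free)
        ; within-new = λ u v q'uv → weights-separated (λ x y → q' x y ≡ true) (λ {x} {y} qxy → trans (q'-sym y x) qxy)
                                  (λ q≡t → true≢false (trans (sym q≡t) q'uv)) (pathEdges⇒earEdges new-edges)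
        ; degrees-new = degrees-new
        ; rebalances = rebalances
        ; anchors = λ v S'v Sv → ear-reaches (weights-sym L) (λ _ → left , left∈S , ε) right∈S
                                   (weights-at distinct-ends (pathEdges⇒earEdges-pairs apart)) path anchor (∪-new {S} S'v Sv)
        }
      where
      R : Fin n → ℕ
      R p = toℕ (residue (f p))
      Σwtf = sumFin n (λ v → wt v * f v)
      κ = residue Σwtf
      rs = map (residue ∘ f) inner
      toℕ-rs : map toℕ rs ≡ map R inner
      toℕ-rs = sym (map-∘ inner)
      hypothesis : μ * toℕ κ + weighted (map wt' inner) (map toℕ rs) ≡₄ 0
      hypothesis = begin
        μ * toℕ κ + weighted (map wt' inner) (map toℕ rs)
          ≡⟨ cong (λ xs → μ * toℕ κ + weighted (map wt' inner) xs) toℕ-rs ⟩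
        μ * toℕ κ + weighted (map wt' inner) (map R inner)
          ≈⟨ +-cong₄ (*-congˡ₄ μ (toℕ-residue Σwtf)) (weighted-map₄ (map wt' inner) inner (toℕ-residue ∘ f)) ⟩
        μ * Σwtf + weighted (map wt' inner) (map f inner)
          ≈⟨ balance-split {inner} μ f split balanced ⟩
        0 ∎
        where open ≡₄-Reasoning
      solution = EarArithmetic.solve arithmetic κ rs (trans (length-map _ inner) (sym (length-map wt' inner))) hypothesis
      t = toℕ (proj₁ solution)
      anchor : T (anchored true t (map R inner))
      anchor = subst (T ∘ anchored true t) toℕ-rs (proj₁ (proj₂ solution))
      L = earEdges R t left inner right
      Y = weights L
      adjacent = pathEdges⇒earEdges {r = R} {t} path
      distinct-ends = All.map Adj⇒≢ adjacent
      inner≢right = All.map (λ x≢e → x≢e ∘ sym) (fresh-≢ right∈S inner∉S)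
      apart = pathEdges-apart (fresh-≢ left∈S inner∉S) inner-unique inner≢right ends-apart
      degrees-new : ∀ v → (S ∪ inner) v ≡ true → S v ≡ false → degree Y v ≡₄ f v
      degrees-new v S'v Sv = begin
        degree Y v    ≡⟨ degree-weights adjacent v ⟩
        incidence L v ≈⟨ incidence-inner inner-unique (fresh-≢ left∈S inner∉S) inner≢right (∪-new {S} S'v Sv) ⟩
        R v           ≈⟨ toℕ-residue (f v) ⟩
        f v           ∎
        where open ≡₄-Reasoning
      rebalances : Balanced wt (λ v → f v + 3 * degree Y v)
      rebalances = begin
        sumFin n (λ v → wt v * (f v + 3 * degree Y v))
          ≡⟨ balance-shift wt f adjacent ⟩
        Σwtf + 3 * load wt L
          ≡⟨ cong (λ x → Σwtf + 3 * x) (load-ear wt (All.map (off-S _) inner∉S)) ⟩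
        Σwtf + 3 * (t * wt left + chainEnd t (map R inner) * wt right)
          ≈⟨ +-cong₄ (≡₄-sym (toℕ-residue Σwtf)) ≡₄-refl ⟩
        toℕ κ + 3 * (t * wt left + chainEnd t (map R inner) * wt right)
          ≡⟨ cong (λ xs → toℕ κ + 3 * (t * wt left + chainEnd t xs * wt right)) toℕ-rs ⟨
        toℕ κ + 3 * (t * wt left + chainEnd t (map toℕ rs) * wt right)
          ≈⟨ proj₂ (proj₂ solution) ⟩
        0 ∎
        where open ≡₄-Reasoning

  -- The two kinds of stages

  inside : VertexSet → EdgeSet
  inside S u v = S u ∧ S v

  crossing : VertexSet → (Fin n → Bool) → EdgeSet
  crossing S c u v = inside S u v ∧ (c u xor c v)

  -- Balanced (parityWeight S) f says that Σ_S f is even; Balanced (colourClassWeight S c) f that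
  -- Σ_U f ≡ Σ_W f (mod 4) for the colour classes U = c⁻¹(true) and W = c⁻¹(false) of S.
  parityWeight : VertexSet → Fin n → ℕ
  parityWeight S v = if S v then 2 else 0

  colourClassWeight : VertexSet → (Fin n → Bool) → Fin n → ℕ
  colourClassWeight S c v = if S v then colourWeight (c v) else 0

  data Stage (S : VertexSet) : Set where
    general : Solvable S (inside S) (parityWeight S) → Stage S
    bipartite : (c : Fin n → Bool) → Solvable S (crossing S c) (colourClassWeight S c) → Stage S

  recolour : (Fin n → Bool) → List (Fin n) → Bool → Fin n → Bool
  recolour c [] col v = c v
  recolour c (p ∷ ps) col v = if v ≡ᵇ p then col else recolour c ps (not col) v

  inside-sym : ∀ S u v → inside S u v ≡ inside S v u
  inside-sym S u v = ∧-comm (S u) (S v)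

  crossing-sym : ∀ S c u v → crossing S c u v ≡ crossing S c v u
  crossing-sym S c u v = cong₂ _∧_ (inside-sym S u v) (xor-comm (c u) (c v))

  inside-left : ∀ S u v → inside S u v ≡ true → S u ≡ true
  inside-left S u v Suv with S u
  ... | true = refl

  crossing-left : ∀ S c u v → crossing S c u v ≡ true → S u ≡ true
  crossing-left S c u v Cuv with inside S u v in Suv
  ... | true = inside-left S u v Suv

  inside-mono : ∀ {S S'} → S ⊆ S' → ∀ u v → inside S u v ≡ true → inside S' u v ≡ true
  inside-mono {S} S⊆S' u v Suv with S u in Su | S v in Sv
  ... | true | true rewrite S⊆S' u Su | S⊆S' v Sv = refl

  crossing⊆inside : ∀ {S S'} c → S ⊆ S' → ∀ u v → crossing S c u v ≡ true → inside S' u v ≡ true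
  crossing⊆inside {S} c S⊆S' u v Cuv with inside S u v in Suv
  ... | true = inside-mono S⊆S' u v Suv

  crossing-mono : ∀ {S S' c c'} → S ⊆ S' → (∀ v → S v ≡ true → c' v ≡ c v) →
    ∀ u v → crossing S c u v ≡ true → crossing S' c' u v ≡ true
  crossing-mono {S} {S'} {c} {c'} S⊆S' same u v Cuv with S u in Su | S v in Sv
  ... | true | true rewrite S⊆S' u Su | S⊆S' v Sv | same u Su | same v Sv = Cuv

  leaving-inside : ∀ {S u v} → S u ≡ false ⊎ S v ≡ false → inside S u v ≡ false
  leaving-inside {S} {u} (inj₁ Su) rewrite Su = refl
  leaving-inside {S} {u} {v} (inj₂ Sv) rewrite Sv = ∧-zeroʳ (S u)

  leaving-crossing : ∀ {S c u v} → S u ≡ false ⊎ S v ≡ false → crossing S c u v ≡ false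
  leaving-crossing {S} {c} {u} {v} out rewrite leaving-inside {S} {u} {v} out = refl

  pathEdges-leave : ∀ {S : VertexSet} {x ps b} → 1 ≤ length ps → All (λ p → S p ≡ false) ps →
    All (λ (u , v) → S u ≡ false ⊎ S v ≡ false) (pathEdges x ps b)
  pathEdges-leave {ps = p ∷ []} _ (Sp ∷ []) = inj₂ Sp ∷ inj₁ Sp ∷ []
  pathEdges-leave {ps = p ∷ q ∷ qs} _ (Sp ∷ fresh) = inj₂ Sp ∷ pathEdges-leave (s≤s z≤n) fresh

  pathEdges-within : ∀ {P : Fin n → Set} {x ps b} → P x → All P ps → P b → All (λ (u , v) → P u × P v) (pathEdges x ps b)
  pathEdges-within Px [] Pb = (Px , Pb) ∷ []
  pathEdges-within Px (Pp ∷ Pps) Pb = (Px , Pp) ∷ pathEdges-within Pp Pps Pb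

  xor-alternates : ∀ {a b col} → a ≡ col → b ≡ not col → a xor b ≡ true
  xor-alternates {col = true} refl refl = refl
  xor-alternates {col = false} refl refl = refl

  pathEdges-alternate : ∀ {c : Fin n → Bool} {x ps b} col → c x ≡ col → map c ps ≡ alternating (not col) (length ps) →
    c b ≡ nextColour (not col) (length ps) → All (λ (u , v) → c u xor c v ≡ true) (pathEdges x ps b)
  pathEdges-alternate {ps = []} col cx _ cb = xor-alternates cx cb ∷ []
  pathEdges-alternate {ps = p ∷ ps} col cx colours cb with ∷-injective colours
  ... | cp , rest = xor-alternates cx cp ∷ pathEdges-alternate (not col) cp rest cb

  recolour-∉ : ∀ {c ps col v} → v ∉ ps → recolour c ps col v ≡ c v
  recolour-∉ {ps = []} _ = refl
  recolour-∉ {c} {p ∷ ps} {col} {v} v∉ rewrite ≢⇒≡ᵇ-false (v∉ ∘ here) = recolour-∉ (v∉ ∘ there)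

  recolour-inner : ∀ {c} ps col → Unique ps → map (recolour c ps col) ps ≡ alternating col (length ps)
  recolour-inner [] col [] = refl
  recolour-inner {c} (p ∷ ps) col (p∉ps ∷ unique) rewrite ≡ᵇ-refl p =
    cong (col ∷_) (trans (skip ps p∉ps) (recolour-inner ps (not col) unique))
    where
    skip : ∀ qs → All (p ≢_) qs → map (recolour c (p ∷ ps) col) qs ≡ map (recolour c ps (not col)) qs
    skip [] [] = refl
    skip (q ∷ qs) (p≢q ∷ p∉qs) rewrite ≢⇒≡ᵇ-false (p≢q ∘ sym) = cong (_ ∷_) (skip qs p∉qs)

  map-constant : ∀ {A : Set} {g : A → ℕ} {a xs} → All (λ x → g x ≡ a) xs → map g xs ≡ replicate (length xs) a
  map-constant [] = refl
  map-constant (gx ∷ gxs) = cong₂ _∷_ gx (map-constant gxs)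

  EarArithmetic-resp : ∀ {μ A A' B B' ws ws'} → A ≡ A' → B ≡ B' → ws ≡ ws' →
    EarArithmetic μ A' B' ws' → EarArithmetic μ A B ws
  EarArithmetic-resp refl refl refl arithmetic = arithmetic

  parity-in : ∀ S {v} → S v ≡ true → parityWeight S v ≡ 2
  parity-in S Sv rewrite Sv = refl

  parity-off : ∀ S v → S v ≡ false → parityWeight S v ≡ 0
  parity-off S v Sv rewrite Sv = refl

  colourClass-in : ∀ S c {v} → S v ≡ true → colourClassWeight S c v ≡ colourWeight (c v)
  colourClass-in S c Sv rewrite Sv = refl

  colourClass-off : ∀ S c v → S v ≡ false → colourClassWeight S c v ≡ 0
  colourClass-off S c v Sv rewrite Sv = refl

  inside-true : ∀ S {u v} → S u ≡ true → S v ≡ true → inside S u v ≡ true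
  inside-true S Su Sv rewrite Su | Sv = refl

  2≡₄2*colourWeight : ∀ b → 2 ≡₄ 2 * colourWeight b
  2≡₄2*colourWeight true = ≡₄-refl
  2≡₄2*colourWeight false = mod4 refl

  nextColour-3 : ∀ b → nextColour (not b) 3 ≡ b
  nextColour-3 true = refl
  nextColour-3 false = refl

  -- Without inner vertices an incompatible ear is a single edge whose ends have the same colour.
  odd-ear-leaves : ∀ {S x ps b} c → All (λ p → S p ≡ false) ps → c b ≡ not (nextColour (not (c x)) (length ps)) →
    All (λ (u , v) → crossing S c u v ≡ false) (pathEdges x ps b)
  odd-ear-leaves {S} {x} {[]} {b} c [] cb = same-colour (trans cb (not-involutive (c x))) ∷ []
    where same-colour : c b ≡ c x → crossing S c x b ≡ false
          same-colour cb≡cx rewrite cb≡cx | xor-same (c x) = ∧-zeroʳ (inside S x b)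
  odd-ear-leaves {S} {ps = p ∷ ps} c fresh _ = All.map (leaving-crossing {S} {c}) (pathEdges-leave (s≤s z≤n) fresh)

  module _ {S : VertexSet} (ear : Ear S) where
    open Ear ear

    S' : VertexSet
    S' = S ∪ inner

    earColouring : (Fin n → Bool) → Fin n → Bool
    earColouring c = recolour c inner (not (c left))

    private
      S⊆S' = ⊆-∪ {S} inner
      ends∈S' : ∀ {P : Fin n × Fin n → Set} → (∀ {u v} → S' u ≡ true → S' v ≡ true → P (u , v)) →
                All P (pathEdges left inner right)
      ends∈S' within = All.map (λ (S'u , S'v) → within S'u S'v)
                              (pathEdges-within (S⊆S' left left∈S) (All.tabulate (∈-∪ {S})) (S⊆S' right right∈S))
      parity-inner : map (parityWeight S') inner ≡ replicate (length inner) 2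
      parity-inner = map-constant (All.tabulate λ p∈ → parity-in S' (∈-∪ {S} p∈))

    extend-general : 1 ≤ length inner → length inner ≤ 3 →
      Solvable S (inside S) (parityWeight S) → Solvable S' (inside S') (parityWeight S')
    extend-general nonempty short solvable =
      extendSolvable {wt' = parityWeight S'} S⊆S' (inside-mono S⊆S') (inside-left S) solvable
        (earPatch ear {wt' = parityWeight S'} (inside-sym S) (inside-sym S')
          (All.map (leaving-inside {S}) (pathEdges-leave nonempty inner∉S)) (ends∈S' (inside-true S')) (parity-off S)
          (weight-split 1 inner∉S inner-unique
             (λ v Sv → ≡⇒≡₄ (trans (parity-in S' (S⊆S' v Sv)) (sym (cong (1 *_) (parity-in S Sv)))))
             (parity-off S) (parity-off S'))
          (EarArithmetic-resp (parity-in S left∈S) (parity-in S right∈S) parity-inner (earArithmetic-general short)))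

    extend-bipartite : ∀ c → 1 ≤ length inner → length inner ≤ 3 → c right ≡ nextColour (not (c left)) (length inner) →
      Solvable S (crossing S c) (colourClassWeight S c) →
      Solvable S' (crossing S' (earColouring c)) (colourClassWeight S' (earColouring c))
    extend-bipartite c nonempty short compatible solvable =
      extendSolvable {wt' = colourClassWeight S' c'} S⊆S' (crossing-mono S⊆S' unchanged) (crossing-left S c) solvable
        (earPatch ear {wt' = colourClassWeight S' c'} (crossing-sym S c) (crossing-sym S' c')
          (All.map (leaving-crossing {S} {c}) (pathEdges-leave nonempty inner∉S))
          (All.zipWith (λ (inside , alternates) → cong₂ _∧_ inside alternates)
             (ends∈S' (inside-true S') , pathEdges-alternate (c left) (unchanged left left∈S) (recolour-inner inner _ inner-unique)
                                      (trans (unchanged right right∈S) compatible)))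
          (colourClass-off S c)
          (weight-split 1 inner∉S inner-unique old-weights (colourClass-off S c) (colourClass-off S' c'))
          (EarArithmetic-resp (colourClass-in S c left∈S)
             (trans (colourClass-in S c right∈S) (cong colourWeight compatible)) inner-weights
             (earArithmetic-bipartite (c left) short)))
      where
      c' = earColouring c
      unchanged : ∀ v → S v ≡ true → c' v ≡ c v
      unchanged v Sv = recolour-∉ (fresh-∉ Sv inner∉S)
      old-weights : ∀ v → S v ≡ true → colourClassWeight S' c' v ≡₄ 1 * colourClassWeight S c v
      old-weights v Sv = ≡⇒≡₄ (begin
        colourClassWeight S' c' v ≡⟨ colourClass-in S' c' (S⊆S' v Sv) ⟩
        colourWeight (c' v)       ≡⟨ cong colourWeight (unchanged v Sv) ⟩
        colourWeight (c v)        ≡⟨ colourClass-in S c Sv ⟨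
        colourClassWeight S c v   ≡⟨ *-identityˡ _ ⟨
        1 * colourClassWeight S c v ∎)
        where open ≡-Reasoning
      inner-weights : map (colourClassWeight S' c') inner ≡ map colourWeight (alternating (not (c left)) (length inner))
      inner-weights = begin
        map (colourClassWeight S' c') inner  ≡⟨ map-cong-local (All.tabulate λ p∈ → colourClass-in S' c' (∈-∪ {S} p∈)) ⟩
        map (colourWeight ∘ c') inner        ≡⟨ map-∘ inner ⟩
        map colourWeight (map c' inner)      ≡⟨ cong (map colourWeight) (recolour-inner inner _ inner-unique) ⟩
        map colourWeight (alternating (not (c left)) (length inner)) ∎
        where open ≡-Reasoning

    extend-odd : ∀ c → length inner ≤ 2 → c right ≡ not (nextColour (not (c left)) (length inner)) →
      Solvable S (crossing S c) (colourClassWeight S c) → Solvable S' (inside S') (parityWeight S')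
    extend-odd c short incompatible solvable =
      extendSolvable {wt' = parityWeight S'} S⊆S' (crossing⊆inside c S⊆S') (crossing-left S c) solvable
        (earPatch ear {wt' = parityWeight S'} (crossing-sym S c) (inside-sym S')
          (odd-ear-leaves c inner∉S incompatible) (ends∈S' (inside-true S')) (colourClass-off S c)
          (weight-split 2 inner∉S inner-unique old-weights (colourClass-off S c) (parity-off S'))
          (EarArithmetic-resp (colourClass-in S c left∈S) (trans (colourClass-in S c right∈S) (cong colourWeight incompatible))
             parity-inner (earArithmetic-odd (c left) short)))
      where
      old-weights : ∀ v → S v ≡ true → parityWeight S' v ≡₄ 2 * colourClassWeight S c v
      old-weights v Sv rewrite parity-in S' (S⊆S' v Sv) | colourClass-in S c Sv = 2≡₄2*colourWeight (c v)

    Absorbable : Set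
    Absorbable = 1 ≤ length inner × (length inner ≤ 2 ⊎ (length inner ≡ 3 × left ≡ right))

    private
      at-most-3 : length inner ≤ 2 ⊎ (length inner ≡ 3 × left ≡ right) → length inner ≤ 3
      at-most-3 (inj₁ short) = m≤n⇒m≤1+n short
      at-most-3 (inj₂ (length≡3 , _)) = ≤-reflexive length≡3

    extend : Absorbable → Stage S → Stage S'
    extend (nonempty , shape) (general solvable) = general (extend-general nonempty (at-most-3 shape) solvable)
    extend (nonempty , shape) (bipartite c solvable) with c right BP.≟ nextColour (not (c left)) (length inner)
    ... | yes compatible = bipartite (earColouring c) (extend-bipartite c nonempty (at-most-3 shape) compatible solvable)
    ... | no incompatible = general (extend-odd c (open-ear shape) (¬-not incompatible) solvable)
      where
      -- A closed ear of length 3 is always compatible with the colouring.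
      open-ear : length inner ≤ 2 ⊎ (length inner ≡ 3 × left ≡ right) → length inner ≤ 2
      open-ear (inj₁ short) = short
      open-ear (inj₂ (length≡3 , left≡right)) = ⊥-elim (incompatible (begin
        c right                                  ≡⟨ cong c left≡right ⟨
        c left                                   ≡⟨ nextColour-3 (c left) ⟨
        nextColour (not (c left)) 3              ≡⟨ cong (nextColour (not (c left))) length≡3 ⟨
        nextColour (not (c left)) (length inner) ∎))
        where open ≡-Reasoning

  -- Short cycles and the growth of stages

  data ShortCycle (u v : Fin n) : Set where
    triangle : ∀ w → Adj G v w → Adj G w u → ShortCycle u v
    square : ∀ w z → Adj G v w → Adj G w z → Adj G z u → u ≢ w → v ≢ z → ShortCycle u v

  module _ (u v : Fin n) where
    private
      H = AdjMinus G u v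

    open Walks H

    Deleted? : ∀ x y → Dec ((x ≡ u × y ≡ v) ⊎ (x ≡ v × y ≡ u))
    Deleted? x y = ((x FP.≟ u) ×-dec (y FP.≟ v)) ⊎-dec ((x FP.≟ v) ×-dec (y FP.≟ u))

    H? : ∀ x y → Dec (H x y)
    H? x y = (adj G x y BP.≟ true) ×-dec ¬? (Deleted? x y)

    -- A chordless walk from v to u avoiding the edge uv closes up with uv into an induced cycle.
    module InducedCycle (uv : Adj G u v) (w : Walk v u) (chordless : Chordless w) where
      open Walk w

      private
        index≤len : ∀ (a : Fin (suc len)) → toℕ a ≤ len
        index≤len a = ≤-pred (FP.toℕ<n a)

        distinct< : ∀ i j → i < j → j ≤ len → pt i ≢ pt j
        distinct< i j i<j j≤len pti≡ptj with suc i ≟ j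
        ... | yes refl = Adj⇒≢ (proj₁ (steps i (<-≤-trans i<j j≤len))) pti≡ptj
        ... | no 1+i≢j = chordless i j (subst (_≤ j) (+-comm 2 i) (≤∧≢⇒< i<j 1+i≢j) , j≤len , inj₂ pti≡ptj)

        pt-injective : ∀ i j → i ≤ len → j ≤ len → pt i ≡ pt j → i ≡ j
        pt-injective i j i≤len j≤len eq with <-cmp i j
        ... | tri< i<j _ _ = ⊥-elim (distinct< i j i<j j≤len eq)
        ... | tri≈ _ i≡j _ = i≡j
        ... | tri> _ _ j<i = ⊥-elim (distinct< j i j<i i≤len (sym eq))

      cycle : Fin (suc len) → Fin n
      cycle a = pt (toℕ a)

      private
        next⇒adj : ∀ a b → CycNext a b → Adj G (cycle a) (cycle b)
        next⇒adj a b next with toℕ a <? len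
        ... | yes a<len = subst (λ k → Adj G (pt (toℕ a)) (pt k)) (sym (trans next (m<n⇒m%n≡m (s≤s a<len))))
                                (proj₁ (steps (toℕ a) a<len))
        ... | no a≮len = subst₂ (λ i j → Adj G (pt i) (pt j)) (sym a≡len) (sym b≡0) (subst₂ (Adj G) (sym end) (sym start) uv)
          where
          a≡len : toℕ a ≡ len
          a≡len = ≤-antisym (index≤len a) (≮⇒≥ a≮len)
          b≡0 : toℕ b ≡ 0
          b≡0 = trans next (trans (cong (λ k → suc k % suc len) a≡len) (n%n≡0 (suc len)))

        forward : ∀ a b → toℕ a < toℕ b → Adj G (cycle a) (cycle b) → CycAdj a b
        forward a b a<b ab with suc (toℕ a) ≟ toℕ b
        ... | yes 1+a≡b = inj₁ (sym (trans (m<n⇒m%n≡m (s≤s (subst (_≤ len) (sym 1+a≡b) (index≤len b)))) 1+a≡b))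
        ... | no 1+a≢b with Deleted? (cycle a) (cycle b)
        ...   | no kept = ⊥-elim (chordless (toℕ a) (toℕ b)
                            (subst (_≤ toℕ b) (+-comm 2 (toℕ a)) (≤∧≢⇒< a<b 1+a≢b) , index≤len b , inj₁ (ab , kept)))
        ...   | yes (inj₁ (a≡u , _)) = ⊥-elim (<⇒≱ a<b (subst (toℕ b ≤_)
                            (sym (pt-injective (toℕ a) len (index≤len a) ≤-refl (trans a≡u (sym end)))) (index≤len b)))
        ...   | yes (inj₂ (a≡v , b≡u)) =
          inj₂ (trans a≡0 (sym (trans (cong (λ k → suc k % suc len) b≡len) (n%n≡0 (suc len)))))
          where
          a≡0 : toℕ a ≡ 0
          a≡0 = pt-injective (toℕ a) 0 (index≤len a) z≤n (trans a≡v (sym start))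
          b≡len : toℕ b ≡ len
          b≡len = pt-injective (toℕ b) len (index≤len b) ≤-refl (trans b≡u (sym end))

        adj⇒cycAdj : ∀ a b → Adj G (cycle a) (cycle b) → CycAdj a b
        adj⇒cycAdj a b ab with <-cmp (toℕ a) (toℕ b)
        ... | tri< a<b _ _ = forward a b a<b ab
        ... | tri≈ _ a≡b _ = ⊥-elim (Adj⇒≢ ab (cong pt a≡b))
        ... | tri> _ _ b<a with forward b a b<a (Adj-sym ab)
        ...   | inj₁ next = inj₂ next
        ...   | inj₂ next = inj₁ next

        cycAdj⇒adj : ∀ a b → CycAdj a b → Adj G (cycle a) (cycle b)
        cycAdj⇒adj a b (inj₁ next) = next⇒adj a b next
        cycAdj⇒adj a b (inj₂ next) = Adj-sym (next⇒adj b a next)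

      inducedCycle : HasInducedCycle G (suc len)
      inducedCycle =
        cycle ,
        (λ {a} {b} eq → FP.toℕ-injective (pt-injective (toℕ a) (toℕ b) (index≤len a) (index≤len b) eq)) ,
        λ a b → mk⇔ (adj⇒cycAdj a b) (cycAdj⇒adj a b)

    shortCycle : Adj G u v → ConnectedRel H → C≥5-free G → ShortCycle u v
    shortCycle uv connected free with chordless H? FP._≟_ (fromStar (connected v u))
    ... | w , chordless = by-length (Walk.len w) refl
      where
      open Walk w
      step : ∀ i → i < len → Adj G (pt i) (pt (suc i))
      step i i<len = proj₁ (steps i i<len)
      by-length : ∀ k → k ≡ len → ShortCycle u v
      by-length zero refl = ⊥-elim (Adj⇒≢ uv (trans (sym end) start))
      by-length 1 refl = ⊥-elim (proj₂ (steps 0 (s≤s z≤n)) (inj₂ (start , end)))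
      by-length 2 refl = triangle (pt 1) (subst (λ x → Adj G x (pt 1)) start (step 0 (s≤s z≤n)))
                                         (subst (Adj G (pt 1)) end (step 1 (s≤s (s≤s z≤n))))
      by-length 3 refl = square (pt 1) (pt 2) (subst (λ x → Adj G x (pt 1)) start (step 0 (s≤s z≤n)))
                           (step 1 (s≤s (s≤s z≤n))) (subst (Adj G (pt 2)) end (step 2 (s≤s (s≤s (s≤s z≤n)))))
                           (λ u≡pt1 → chordless 1 3 (≤-refl , ≤-refl , inj₂ (trans (sym u≡pt1) (sym end))))
                           (λ v≡pt2 → chordless 0 2 (≤-refl , s≤s (s≤s z≤n) , inj₂ (trans start v≡pt2)))
      by-length (suc (suc (suc (suc k)))) refl =
        ⊥-elim (free (suc len) (s≤s (s≤s (s≤s (s≤s (s≤s z≤n))))) (InducedCycle.inducedCycle uv w chordless))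


  crossingEdge : ∀ (S : VertexSet) {s t} → S s ≡ true → S t ≡ false → Star (Adj G) s t →
    ∃ λ x → ∃ λ y → S x ≡ true × S y ≡ false × Adj G x y
  crossingEdge S Ss St ε = ⊥-elim (true≢false (trans (sym Ss) St))
  crossingEdge S {s} Ss St (_◅_ {j = s'} ss' rest) with S s' in Ss'
  ... | true = crossingEdge S Ss' St rest
  ... | false = s , s' , Ss , Ss' , ss'

  private
    single-ear : ∀ {S a p b} → S a ≡ true → S b ≡ true → S p ≡ false → a ≢ b → Adj G a p → Adj G p b →
      Σ (Ear S) Absorbable
    single-ear {a = a} {p} {b} Sa Sb Sp a≢b ap pb =
      record { left = a ; right = b ; inner = p ∷ [] ; path = ap ∷ pb ∷ [] ; left∈S = Sa ; right∈S = Sb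
             ; inner∉S = Sp ∷ [] ; inner-unique = [] ∷ [] ; ends-apart = a≢b } ,
      s≤s z≤n , inj₁ (s≤s z≤n)

    double-ear : ∀ {S a p q b} → S a ≡ true → S b ≡ true → S p ≡ false → S q ≡ false → p ≢ q →
      Adj G a p → Adj G p q → Adj G q b → Σ (Ear S) Absorbable
    double-ear {a = a} {p} {q} {b} Sa Sb Sp Sq p≢q ap pq qb =
      record { left = a ; right = b ; inner = p ∷ q ∷ [] ; path = ap ∷ pq ∷ qb ∷ [] ; left∈S = Sa ; right∈S = Sb
             ; inner∉S = Sp ∷ Sq ∷ [] ; inner-unique = (p≢q ∷ []) ∷ [] ∷ [] ; ends-apart = _ } ,
      s≤s z≤n , inj₁ (s≤s (s≤s z≤n))

    closed-ear : ∀ {S a p q r} → S a ≡ true → S p ≡ false → S q ≡ false → S r ≡ false →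
      p ≢ q → p ≢ r → q ≢ r →
      Adj G a p → Adj G p q → Adj G q r → Adj G r a → Σ (Ear S) Absorbable
    closed-ear {a = a} {p} {q} {r} Sa Sp Sq Sr p≢q p≢r q≢r ap pq qr ra =
      record { left = a ; right = a ; inner = p ∷ q ∷ r ∷ [] ; path = ap ∷ pq ∷ qr ∷ ra ∷ []
             ; left∈S = Sa ; right∈S = Sa
             ; inner∉S = Sp ∷ Sq ∷ Sr ∷ [] ; inner-unique = (p≢q ∷ p≢r ∷ []) ∷ (q≢r ∷ []) ∷ [] ∷ []
             ; ends-apart = _ } ,
      s≤s z≤n , inj₂ (refl , refl)

  EarFinder : Set
  EarFinder = ∀ {S} → ∃ (λ s → S s ≡ true) → ∃ (λ t → S t ≡ false) → Σ (Ear S) Absorbable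

  -- An edge xy leaving S lies on a triangle or an induced square; the part of it outside S is an ear.
  findEar : TwoEdgeConnected G → C≥5-free G → EarFinder
  findEar (connected , bridgeless) free {S} (s , Ss) (t , St) with crossingEdge S Ss St (connected s t)
  ... | x , y , Sx , Sy , xy with shortCycle x y xy (bridgeless x y xy) free
  ...   | triangle w yw wx with S w in Sw
  ...     | true = single-ear Sx Sw Sy (Adj⇒≢ (Adj-sym wx)) xy yw
  ...     | false = double-ear Sx Sx Sy Sw (Adj⇒≢ yw) xy yw wx
  findEar _ _ {S} _ _ | x , y , Sx , Sy , xy | square w z yw wz zx x≢w y≢z with S w in Sw
  ...     | true = single-ear Sx Sw Sy x≢w xy yw
  ...     | false with S z in Sz
  ...       | true = double-ear Sx Sz Sy Sw (Adj⇒≢ yw) xy yw wz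
  ...       | false = closed-ear Sx Sy Sw Sz (Adj⇒≢ yw) y≢z (Adj⇒≢ wz) xy yw wz zx

  missing : VertexSet → ℕ
  missing S = sumFin n (λ v → 𝟙 (not (S v)))

  missing-< : ∀ {S S' p} → S ⊆ S' → S p ≡ false → S' p ≡ true → missing S' < missing S
  missing-< {S} {S'} {p} S⊆S' Sp S'p = sumFin-mono-< n fewer p (strictly-fewer Sp S'p)
    where
    fewer : ∀ v → 𝟙 (not (S' v)) ≤ 𝟙 (not (S v))
    fewer v with S v in Sv | S' v in S'v
    ... | true | true = z≤n
    ... | true | false = ⊥-elim (true≢false (trans (sym (S⊆S' v Sv)) S'v))
    ... | false | true = z≤n
    ... | false | false = s≤s z≤n
    strictly-fewer : ∀ {b b'} → b ≡ false → b' ≡ true → 𝟙 (not b') < 𝟙 (not b)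
    strictly-fewer refl refl = s≤s z≤n

  FullStage : Set
  FullStage = ∃ λ S → (∀ v → S v ≡ true) × Stage S

  grow : ∀ s₀ → EarFinder → ∀ k S → missing S ≤ k → S s₀ ≡ true → Stage S → FullStage
  grow s₀ ears k S missing≤k Ss₀ stage with FP.all? (λ v → S v BP.≟ true)
  ... | yes full = S , full , stage
  ... | no ¬full with FP.¬∀⟶∃¬ n _ (λ v → S v BP.≟ true) ¬full
  ...   | t , ¬St with k | ears (s₀ , Ss₀) (t , BP.¬-not ¬St)
  ...     | zero | _ = ⊥-elim (1≰0 (≤-trans t-missing (≤-trans (sumFin-term-≤ n _ t) missing≤k)))
    where
    t-missing : 1 ≤ 𝟙 (not (S t))
    t-missing = subst (λ b → 1 ≤ 𝟙 (not b)) (sym (BP.¬-not ¬St)) (s≤s z≤n)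
    1≰0 : ¬ (1 ≤ 0)
    1≰0 ()
  ...     | suc k | ear , absorbable@(nonempty , _) =
    grow s₀ ears k (S ∪ inner) (≤-pred (≤-trans (missing-< (⊆-∪ {S} inner) Sp S'p) missing≤k))
      (⊆-∪ {S} inner s₀ Ss₀) (extend ear absorbable stage)
    where
    open Ear ear using (inner; inner∉S)
    member : ∀ {ps : List (Fin n)} → 1 ≤ length ps → ∃ (_∈ ps)
    member {p ∷ _} _ = p , here refl
    p∈ = proj₂ (member nonempty)
    Sp = All.lookup inner∉S p∈
    S'p = ∈-∪ {S} p∈

  singleton : Fin n → VertexSet
  singleton s₀ v = v ≡ᵇ s₀

  singletonStage : ∀ s₀ → Stage (singleton s₀)
  singletonStage s₀ = bipartite (λ _ → true) solvable
    where
    solvable : Solvable (singleton s₀) (crossing (singleton s₀) (λ _ → true))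
                        (colourClassWeight (singleton s₀) (λ _ → true))
    solvable f balanced = record
      { weight = λ _ _ → 0 ; symmetric = λ _ _ → refl ; supported = λ _ _ _ → ≡₄-refl
      ; degrees = degrees ; connects = connects }
      where
      indicator : ∀ v → colourClassWeight (singleton s₀) (λ _ → true) v * f v ≡ 𝟙 (v ≡ᵇ s₀) * f v
      indicator v with v ≡ᵇ s₀
      ... | true = refl
      ... | false = refl
      f-s₀ : f s₀ ≡₄ 0
      f-s₀ = ≡₄-trans (≡⇒≡₄ (sym (trans (sumFin-cong n indicator) (sumFin-point n s₀ f)))) balanced
      degrees : ∀ v → singleton s₀ v ≡ true → degree (λ _ _ → 0) v ≡₄ f v
      degrees v v≡s₀ = ≡₄-trans (≡⇒≡₄ (sumFin-zero n λ w → *-zeroʳ (𝟙 (adj G v w))))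
                                (≡₄-sym (subst (λ x → f x ≡₄ 0) (sym (≡ᵇ-true {x = v} v≡s₀)) f-s₀))
      connects : ∀ u v → singleton s₀ u ≡ true → singleton s₀ v ≡ true → Star (Live (λ _ _ → 0)) u v
      connects u v u≡s₀ v≡s₀ =
        subst₂ (Star (Live (λ _ _ → 0))) (sym (≡ᵇ-true {x = u} u≡s₀)) (sym (≡ᵇ-true {x = v} v≡s₀)) ε

  fullStage : ∀ s₀ → EarFinder → FullStage
  fullStage s₀ ears =
    grow s₀ ears n (singleton s₀) (sumFin-≤1 n (λ v → indicator≤1 (not (v ≡ᵇ s₀))))
      (≡ᵇ-refl s₀) (singletonStage s₀)
    where
    indicator≤1 : ∀ b → 𝟙 b ≤ 1
    indicator≤1 true = s≤s z≤n
    indicator≤1 false = z≤n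

  toFactor : ∀ {S q} (f : Fin n → Fin 4) → (∀ v → S v ≡ true) → Factor S q (toℕ ∘ f) → HasConnMod4Factor G f
  toFactor f full factor = x , degree-condition , connected
    where
    open Factor factor using (weight; symmetric; connects)
    x : EdgeVec n
    x = record { val = λ u v → residue (weight u v) ; val-sym = λ u v → cong residue (symmetric u v) }
    term : ∀ b m → (if b then toℕ (residue m) else 0) ≡₄ 𝟙 b * m
    term true m = ≡₄-trans (toℕ-residue m) (≡⇒≡₄ (sym (+-identityʳ m)))
    term false m = ≡₄-refl
    degree-condition : ∀ v → degSum G x v % 4 ≡ toℕ (f v)
    degree-condition v = trans (mod4-eq (≡₄-trans (sumFin-cong₄ n (λ w → term (adj G v w) (weight v w)))
                                                  (Factor.degrees factor v (full v))))
                               (m<n⇒m%n≡m (FP.toℕ<n (f v)))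
    live-entry : ∀ {u v} → Live weight u v → Adj G u v × val x u v ≢ F.zero
    live-entry (uv , nonzero) =
      uv , λ residue≡0 → nonzero (≡₄-trans (≡₄-sym (toℕ-residue _)) (≡⇒≡₄ (cong toℕ residue≡0)))
    connected : ConnectedRel (λ u v → Adj G u v × val x u v ≢ F.zero)
    connected u v = Star.map live-entry (connects u v (full u) (full v))

  general⇒AllRound : ∀ {S} → (∀ v → S v ≡ true) → Solvable S (inside S) (parityWeight S) → AllRound G
  general⇒AllRound {S} full solvable f even = toFactor f full (solvable (toℕ ∘ f) balanced)
    where
    balanced : Balanced (parityWeight S) (toℕ ∘ f)
    balanced = ≡₄-trans (≡⇒≡₄ (trans (sumFin-cong n (λ v → cong (_* toℕ (f v)) (parity-in S (full v))))
                                     (sumFin-*ˡ n 2 (toℕ ∘ f))))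
                        (even⇒2*≡₄0 (sumFin n (toℕ ∘ f)) even)

  -- A monochromatic edge is an ear without inner vertices whose absorption makes the stage general.
  bipartite⇒AllRound⊎BipartiteAllRound : ∀ {S} → (∀ v → S v ≡ true) → ∀ c →
    Solvable S (crossing S c) (colourClassWeight S c) → AllRound G ⊎ BipartiteAllRound G
  bipartite⇒AllRound⊎BipartiteAllRound {S} full c solvable
    with FP.any? (λ a → FP.any? (λ b → (adj G a b BP.≟ true) ×-dec (c a BP.≟ c b)))
  ... | yes (a , b , ab , same) =
    inj₁ (general⇒AllRound (λ v → ⊆-∪ {S} [] v (full v))
            (extend-odd edge c z≤n (trans (sym same) (sym (not-involutive (c a)))) solvable))
    where
    edge : Ear S
    edge = record { left = a ; right = b ; inner = [] ; path = ab ∷ [] ; left∈S = full a ; right∈S = full b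
                  ; inner∉S = [] ; inner-unique = [] ; ends-apart = _ }
  ... | no no-monochromatic = inj₂ (c , (λ u v uv same → no-monochromatic (u , v , uv , same)) ,
                                    λ f classes → toFactor f full (solvable (toℕ ∘ f) (balanced f classes)))
    where
    split : ∀ b x → colourWeight b * x ≡ (if b then x else 0) + 3 * (if b then 0 else x)
    split true x = refl
    split false x = refl
    balanced : ∀ (f : Fin n → Fin 4) → let U = sumFin n (λ v → if c v then toℕ (f v) else 0)
                                           W = sumFin n (λ v → if c v then 0 else toℕ (f v)) in
      U % 4 ≡ W % 4 → Balanced (colourClassWeight S c) (toℕ ∘ f)
    balanced f U≡W = begin
      sumFin n (λ v → colourClassWeight S c v * toℕ (f v))
        ≡⟨ sumFin-cong n (λ v → trans (cong (_* toℕ (f v)) (colourClass-in S c (full v))) (split (c v) (toℕ (f v)))) ⟩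
      sumFin n (λ v → (if c v then toℕ (f v) else 0) + 3 * (if c v then 0 else toℕ (f v)))
        ≡⟨ trans (sumFin-+ n _ _) (cong (U +_) (sumFin-*ˡ n 3 _)) ⟩
      U + 3 * W   ≈⟨ +-cong₄ {U} {W} (mod4 U≡W) ≡₄-refl ⟩
      W + 3 * W   ≡⟨ +-comm W (3 * W) ⟩
      3 * W + W   ≈⟨ +-3*-+-≡₄ 0 W ⟩
      0 ∎
      where
      open ≡₄-Reasoning
      U = sumFin n (λ v → if c v then toℕ (f v) else 0)
      W = sumFin n (λ v → if c v then 0 else toℕ (f v))

  fullStage⇒AllRound⊎BipartiteAllRound : FullStage → AllRound G ⊎ BipartiteAllRound G
  fullStage⇒AllRound⊎BipartiteAllRound (S , full , general solvable) = inj₁ (general⇒AllRound full solvable)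
  fullStage⇒AllRound⊎BipartiteAllRound (S , full , bipartite c solvable) =
    bipartite⇒AllRound⊎BipartiteAllRound full c solvable

theorem4p7 : ∀ {n : ℕ} (G : SimpleGraph n) →
    TwoEdgeConnected G → C≥5-free G → AllRound G ⊎ BipartiteAllRound G
theorem4p7 {zero} G _ _ = inj₁ λ f _ → record { val = λ () ; val-sym = λ () } , (λ ()) , (λ ())
theorem4p7 {suc n} G twoEdgeConnected free =
  fullStage⇒AllRound⊎BipartiteAllRound G (fullStage G F.zero (findEar G twoEdgeConnected free))
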